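{- For all $k\geq2$, $$\mathcal{D}_{21\mbox{ - }3\mbox{ - }\ldots\mbox{ - } k}(x)=\mathcal{D}_{2\mbox{ - }1\mbox{ - }3\mbox{ - }\ldots\mbox{ - } k}(x)=G_{k-1}(x)+xG_{k-2}(x).$$
   Context: A permutation $\pi$ is a Dumont permutation (of the first kind) if each even integer in $\pi$ is followed by a smaller integer, and each odd integer is either followed by a larger integer or is the last element of $\pi$. Generalized patterns: letters separated by dashes may be at any distance, adjacent letters (as $21$ in $21\mbox{ - }3\mbox{ - }\cdots\mbox{ - }k$) must be adjacent in the permutation. For a pattern $\tau$, $\mathcal{D}_\tau(x)=\sum_{n\geq0}\mathcal{D}_\tau(n)x^n$ where $\mathcal{D}_\tau(n)$ is the number of Dumont permutations of length $n$ avoiding $1\mbox{ - }3\mbox{ - }2$ and $\tau$. For $r\geq2$ consider $Q_r(x)=1+\frac{x^2Q_{r-1}(x)}{1-x^2Q_{r-2}(x)}$; $G_r(x)$ is its solution with $Q_0=Q_1=1$. -}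

module Defs where

open import Data.Nat using (ℕ; zero; suc; _+_; _*_; _∸_; _≤_; _<_)
open import Data.Nat.Divisibility using (_∣_)
open import Data.Bool using (Bool; true; false)
open import Data.List using (List; []; _∷_; length)
open import Data.List.Relation.Unary.All using (All)
open import Data.List.Relation.Unary.Unique.Propositional using (Unique)
open import Data.List.Membership.Propositional using (_∈_)
open import Data.Product using (Σ; _×_; ∃)
open import Data.Sum using (_⊎_)
open import Relation.Binary.PropositionalEquality using (_≡_)
open import Relation.Nullary using (¬_)
open import Function.Bundles using (_⇔_)

-- Words / permutations.  A permutation of length n is a list of the
-- values 1..n, each occurring exactly once.  Positions are 0-based.

-- value at position i (default 0 outside the list; only used in range)
at : List ℕ → ℕ → ℕ
at []       _       = 0
at (x ∷ _)  zero    = x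
at (_ ∷ xs) (suc i) = at xs i

IsPerm : ℕ → List ℕ → Set
IsPerm n π = length π ≡ n × Unique π × All (λ v → 1 ≤ v × v ≤ n) π

IsDumont : List ℕ → Set
IsDumont π = (i : ℕ) → i < length π →
    (2 ∣ at π i → suc i < length π × at π (suc i) < at π i)
  × (¬ (2 ∣ at π i) → suc i ≡ length π ⊎ (suc i < length π × at π i < at π (suc i)))

-- A pattern of length len has letters
-- val 0, ..., val (len-1) (a permutation of 1..len) and adjacency flags:
-- adj j ≡ true means letters j and j+1 are written without a dash, i.e.
-- must be adjacent in the permutation.

record GPattern : Set where
  field
    len : ℕ
    val : ℕ → ℕ
    adj : ℕ → Bool
open GPattern public

Occurrence : GPattern → List ℕ → (ℕ → ℕ) → Set
Occurrence p π ι =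
    ((a b : ℕ) → a < b → b < len p → ι a < ι b)
  × ((a : ℕ) → a < len p → ι a < length π)
  × ((a : ℕ) → suc a < len p → adj p a ≡ true → ι (suc a) ≡ suc (ι a))
  × ((a b : ℕ) → a < len p → b < len p →
       (val p a < val p b) ⇔ (at π (ι a) < at π (ι b)))

Contains : GPattern → List ℕ → Set
Contains p π = ∃ λ ι → Occurrence p π ι

Avoids : GPattern → List ℕ → Set
Avoids p π = ¬ Contains p π

pat1-3-2 : GPattern
pat1-3-2 = record { len = 3 ; val = v ; adj = λ _ → false }
  where
  v : ℕ → ℕ
  v 0 = 1
  v 1 = 3
  v _ = 2

val213k : ℕ → ℕ
val213k 0 = 2
val213k 1 = 1
val213k n = suc n

pat21-3-k : ℕ → GPattern
pat21-3-k k = record { len = k ; val = val213k ; adj = a }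
  where
  a : ℕ → Bool
  a 0 = true
  a _ = false

pat2-1-3-k : ℕ → GPattern
pat2-1-3-k k = record { len = k ; val = val213k ; adj = λ _ → false }

DumontAvoiding : ℕ → GPattern → List ℕ → Set
DumontAvoiding n τ π = IsPerm n π × IsDumont π × Avoids pat1-3-2 π × Avoids τ π

HasSize : (List ℕ → Set) → ℕ → Set
HasSize P c = Σ (List (List ℕ)) λ L →
  Unique L × length L ≡ c × ((w : List ℕ) → (w ∈ L) ⇔ P w)

Series : Set
Series = ℕ → ℕ

sumTo : ℕ → (ℕ → ℕ) → ℕ
sumTo zero    f = f 0
sumTo (suc n) f = sumTo n f + f (suc n)

one : Series
one zero    = 1
one (suc _) = 0

_⊕_ : Series → Series → Series
(f ⊕ g) n = f n + g n

_⊛_ : Series → Series → Series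
(f ⊛ g) n = sumTo n (λ i → f i * g (n ∸ i))

pow : Series → ℕ → Series
pow A zero    = one
pow A (suc j) = A ⊛ pow A j

-- 1/(1 - A) = Σ_j A^j, valid when A has zero constant term
-- (then A^j contributes nothing to x^n for j > n).
geom : Series → Series
geom A n = sumTo n (λ j → pow A j n)

shift1 : Series → Series
shift1 f zero    = 0
shift1 f (suc n) = f n

shift2 : Series → Series
shift2 f = shift1 (shift1 f)

G : ℕ → Series
G zero          = one
G (suc zero)    = one
G (suc (suc r)) = one ⊕ (shift2 (G (suc r)) ⊛ geom (shift2 (G r)))

{-# OPTIONS --safe #-}
-- Call a block a Dumont, 1-3-2-avoiding arrangement of lo+1, ..., lo+n with lo and n even. In a block
-- of length n + 2 with T = lo + n, the maximum T + 2 is even and T + 1 is odd, so the block is either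
-- (T+2) β (T+1) or α (T+1) (T+2) β with β nonempty, where 1-3-2-avoidance puts α above β and α, β
-- are again blocks. If the block avoids the j-letter pattern 2-1-3-...-j (or 21-3-...-j), then
-- β avoids the (j-1)-letter one in the first shape, and in the second α avoids the (j-2)-letter one
-- and β the j-letter one; conversely these conditions suffice. The generating function B_j of such
-- blocks thus satisfies B_j = 1 + x^2 B_(j-1) + x^2 B_(j-2) (B_j - 1), which is the defining
-- equation of G_(j-1). A 1-3-2-avoiding Dumont permutation of even length is a block with lo = 0;
-- one of odd length m + 1 ends with its odd maximum, preceded by a block avoiding the (k-1)-letter
-- pattern. Hence the count G_(k-1) + x G_(k-2).
module Submission where

open import Defs
open import Data.Bool using (Bool; true; false)
open import Data.Empty using (⊥; ⊥-elim)
open import Data.List using (List; []; _∷_; length; _++_; map; concatMap; applyUpTo; upTo)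
open import Data.List.Membership.Propositional using (_∈_; find; lose)
open import Data.List.Membership.Propositional.Properties
  using (∈-++⁺ˡ; ∈-++⁺ʳ; ∈-++⁻; ∈-∃++; ∈-map⁻; ∈-map⁺; ∈-concatMap⁺; ∈-concatMap⁻; ∈-upTo⁺; ∈-upTo⁻)
open import Data.List.Properties
  using (length-++; length-map; ++-assoc; ∷-injective; ∷-injectiveˡ; ∷-injectiveʳ; ∷ʳ-injectiveˡ; ++-cancelˡ)
open import Data.List.Relation.Unary.All as All using (All; []; _∷_)
import Data.List.Relation.Unary.All.Properties as All
open import Data.List.Relation.Unary.AllPairs using ([]; _∷_)
open import Data.List.Relation.Unary.Any using (here; there)
open import Data.List.Relation.Unary.Unique.Propositional using (Unique)
import Data.List.Relation.Unary.Unique.Propositional.Properties as Unique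
open import Data.Nat
open import Data.Nat.Divisibility using (_∣_; divides; _∣0; ∣m∣n⇒∣m+n; ∣m+n∣m⇒∣n; ∣1⇒≡1)
open import Data.Nat.Properties
open import Algebra.Properties.CommutativeSemigroup +-commutativeSemigroup using (interchange)
open import Data.List.Membership.DecPropositional _≟_ using (_∈?_)
open import Data.Product using (Σ; _×_; _,_; proj₁; proj₂; map₁)
open import Data.Sum using (_⊎_; inj₁; inj₂; [_,_]′) renaming (map to ⊎-map)
open import Data.Unit using (⊤; tt)
open import Function.Bundles using (_⇔_; mk⇔; Equivalence)
open import Function.Construct.Identity using (⇔-id)
open import Relation.Binary.PropositionalEquality
open import Relation.Nullary using (¬_; yes; no)

open ≤-Reasoning

sumTo-cong : ∀ n {f g : ℕ → ℕ} → (∀ i → i ≤ n → f i ≡ g i) → sumTo n f ≡ sumTo n g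
sumTo-cong zero    f≗g = f≗g 0 z≤n
sumTo-cong (suc n) f≗g =
  cong₂ _+_ (sumTo-cong n (λ i i≤n → f≗g i (m≤n⇒m≤1+n i≤n))) (f≗g (suc n) ≤-refl)

sumTo-const-0 : ∀ n → sumTo n (λ _ → 0) ≡ 0
sumTo-const-0 zero    = refl
sumTo-const-0 (suc n) = cong (_+ 0) (sumTo-const-0 n)

sumTo-vanishes : ∀ n {f : ℕ → ℕ} → (∀ i → i ≤ n → f i ≡ 0) → sumTo n f ≡ 0
sumTo-vanishes n f≡0 = trans (sumTo-cong n f≡0) (sumTo-const-0 n)

sumTo-distrib-+ : ∀ n (f g : ℕ → ℕ) → sumTo n (λ i → f i + g i) ≡ sumTo n f + sumTo n g
sumTo-distrib-+ zero    f g = refl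
sumTo-distrib-+ (suc n) f g = begin-equality
  sumTo n (λ i → f i + g i) + (f (suc n) + g (suc n))
    ≡⟨ cong (_+ (f (suc n) + g (suc n))) (sumTo-distrib-+ n f g) ⟩
  (sumTo n f + sumTo n g) + (f (suc n) + g (suc n))
    ≡⟨ interchange (sumTo n f) (sumTo n g) (f (suc n)) (g (suc n)) ⟩
  (sumTo n f + f (suc n)) + (sumTo n g + g (suc n)) ∎

sumTo-*ˡ : ∀ n c (f : ℕ → ℕ) → sumTo n (λ i → c * f i) ≡ c * sumTo n f
sumTo-*ˡ zero    c f = refl
sumTo-*ˡ (suc n) c f = begin-equality
  sumTo n (λ i → c * f i) + c * f (suc n) ≡⟨ cong (_+ c * f (suc n)) (sumTo-*ˡ n c f) ⟩
  c * sumTo n f + c * f (suc n)           ≡⟨ *-distribˡ-+ c (sumTo n f) (f (suc n)) ⟨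
  c * (sumTo n f + f (suc n))             ∎

sumTo-unfoldˡ : ∀ n (f : ℕ → ℕ) → sumTo (suc n) f ≡ f 0 + sumTo n (λ i → f (suc i))
sumTo-unfoldˡ zero    f = refl
sumTo-unfoldˡ (suc n) f = begin-equality
  sumTo (suc n) f + f (suc (suc n))               ≡⟨ cong (_+ f (suc (suc n))) (sumTo-unfoldˡ n f) ⟩
  f 0 + sumTo n (λ i → f (suc i)) + f (suc (suc n)) ≡⟨ +-assoc (f 0) _ _ ⟩
  f 0 + sumTo (suc n) (λ i → f (suc i))           ∎

sumTo-comm : ∀ n m (h : ℕ → ℕ → ℕ) →
             sumTo n (λ i → sumTo m (h i)) ≡ sumTo m (λ j → sumTo n (λ i → h i j))
sumTo-comm zero    m h = refl
sumTo-comm (suc n) m h = begin-equality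
  sumTo n (λ i → sumTo m (h i)) + sumTo m (h (suc n))
    ≡⟨ cong (_+ sumTo m (h (suc n))) (sumTo-comm n m h) ⟩
  sumTo m (λ j → sumTo n (λ i → h i j)) + sumTo m (h (suc n))
    ≡⟨ sumTo-distrib-+ m (λ j → sumTo n (λ i → h i j)) (h (suc n)) ⟨
  sumTo m (λ j → sumTo (suc n) (λ i → h i j)) ∎

sumTo-reverse : ∀ n (f : ℕ → ℕ) → sumTo n f ≡ sumTo n (λ i → f (n ∸ i))
sumTo-reverse zero    f = refl
sumTo-reverse (suc n) f = begin-equality
  sumTo n f + f (suc n)                    ≡⟨ cong (_+ f (suc n)) (sumTo-reverse n f) ⟩
  sumTo n (λ i → f (n ∸ i)) + f (suc n)    ≡⟨ +-comm _ (f (suc n)) ⟩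
  f (suc n) + sumTo n (λ i → f (n ∸ i))    ≡⟨ sumTo-unfoldˡ n (λ i → f (suc n ∸ i)) ⟨
  sumTo (suc n) (λ i → f (suc n ∸ i))      ∎

sumTo-last : ∀ n (f : ℕ → ℕ) → (∀ i → i < n → f i ≡ 0) → sumTo n f ≡ f n
sumTo-last zero    f _   = refl
sumTo-last (suc n) f f≡0 =
  cong (_+ f (suc n)) (sumTo-vanishes n (λ i i≤n → f≡0 i (s≤s i≤n)))

sumTo-truncate : ∀ k m (f : ℕ → ℕ) → k ≤ m → (∀ j → k < j → j ≤ m → f j ≡ 0) →
                 sumTo m f ≡ sumTo k f
sumTo-truncate k zero    f z≤n _   = refl
sumTo-truncate k (suc m) f k≤1+m f≡0 with k ≟ suc m
... | yes refl = refl
... | no k≢1+m = begin-equality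
  sumTo m f + f (suc m) ≡⟨ cong (sumTo m f +_) (f≡0 (suc m) k<1+m ≤-refl) ⟩
  sumTo m f + 0         ≡⟨ +-identityʳ _ ⟩
  sumTo m f             ≡⟨ sumTo-truncate k m f (≤-pred k<1+m) (λ j k<j j≤m → f≡0 j k<j (m≤n⇒m≤1+n j≤m)) ⟩
  sumTo k f             ∎
  where
  k<1+m : k < suc m
  k<1+m = ≤∧≢⇒< k≤1+m k≢1+m

triangle : ℕ → (ℕ → ℕ → ℕ) → ℕ
triangle n h = sumTo n (λ i → sumTo (n ∸ i) (h i))

triangle-step : ∀ n h → triangle (suc n) h ≡ triangle n h + sumTo (suc n) (λ i → h i (suc n ∸ i))
triangle-step n h = begin-equality
  sumTo n (λ i → sumTo (suc n ∸ i) (h i)) + sumTo (suc n ∸ suc n) (h (suc n))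
    ≡⟨ cong₂ _+_ (sumTo-cong n (λ i i≤n → cong (λ t → sumTo t (h i)) (+-∸-assoc 1 i≤n)))
                 (cong (λ t → sumTo t (h (suc n))) (n∸n≡0 n)) ⟩
  sumTo n (λ i → sumTo (n ∸ i) (h i) + h i (suc (n ∸ i))) + h (suc n) 0
    ≡⟨ cong (_+ h (suc n) 0) (sumTo-distrib-+ n _ _) ⟩
  triangle n h + sumTo n (λ i → h i (suc (n ∸ i))) + h (suc n) 0
    ≡⟨ +-assoc (triangle n h) _ _ ⟩
  triangle n h + (sumTo n (λ i → h i (suc (n ∸ i))) + h (suc n) 0)
    ≡⟨ cong (triangle n h +_) (cong₂ _+_ (sumTo-cong n (λ i i≤n → cong (h i) (sym (+-∸-assoc 1 i≤n))))
                                          (cong (h (suc n)) (sym (n∸n≡0 n)))) ⟩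
  triangle n h + sumTo (suc n) (λ i → h i (suc n ∸ i)) ∎

sumTo-antidiagonal-swap : ∀ n (h : ℕ → ℕ → ℕ) →
                          sumTo n (λ i → h i (n ∸ i)) ≡ sumTo n (λ j → h (n ∸ j) j)
sumTo-antidiagonal-swap n h =
  trans (sumTo-reverse n _) (sumTo-cong n (λ j j≤n → cong (h (n ∸ j)) (m∸[m∸n]≡n j≤n)))

triangle-transpose : ∀ n (h : ℕ → ℕ → ℕ) → triangle n h ≡ triangle n (λ j i → h i j)
triangle-transpose zero    h = refl
triangle-transpose (suc n) h = begin-equality
  triangle (suc n) h
    ≡⟨ triangle-step n h ⟩
  triangle n h + sumTo (suc n) (λ i → h i (suc n ∸ i))
    ≡⟨ cong₂ _+_ (triangle-transpose n h) (sumTo-antidiagonal-swap (suc n) h) ⟩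
  triangle n (λ j i → h i j) + sumTo (suc n) (λ j → h (suc n ∸ j) j)
    ≡⟨ triangle-step n (λ j i → h i j) ⟨
  triangle (suc n) (λ j i → h i j) ∎

pow-vanishes : ∀ (A : Series) → A 0 ≡ 0 → ∀ j t → t < j → pow A j t ≡ 0
pow-vanishes A A₀≡0 (suc j) t t<1+j = sumTo-vanishes t term
  where
  term : ∀ i → i ≤ t → A i * pow A j (t ∸ i) ≡ 0
  term zero    _   = cong (_* pow A j t) A₀≡0
  term (suc i) i<t = trans (cong (A (suc i) *_) (pow-vanishes A A₀≡0 j (t ∸ suc i) t∸1+i<j))
                           (*-zeroʳ (A (suc i)))
    where
    t∸1+i<j : t ∸ suc i < j
    t∸1+i<j = <-≤-trans (∸-monoʳ-< (s≤s z≤n) i<t) (≤-pred t<1+j)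

geom-unfold : ∀ (A : Series) → A 0 ≡ 0 → ∀ n → geom A n ≡ (one ⊕ (A ⊛ geom A)) n
geom-unfold A A₀≡0 zero    rewrite A₀≡0 = refl
geom-unfold A A₀≡0 (suc m) = begin-equality
  geom A (suc m)
    ≡⟨ sumTo-unfoldˡ m (λ j → pow A j (suc m)) ⟩
  sumTo m (λ j → sumTo (suc m) (λ i → A i * pow A j (suc m ∸ i)))
    ≡⟨ sumTo-comm m (suc m) (λ j i → A i * pow A j (suc m ∸ i)) ⟩
  sumTo (suc m) (λ i → sumTo m (λ j → A i * pow A j (suc m ∸ i)))
    ≡⟨ sumTo-cong (suc m) (λ i _ → sumTo-*ˡ m (A i) (λ j → pow A j (suc m ∸ i))) ⟩
  sumTo (suc m) (λ i → A i * sumTo m (λ j → pow A j (suc m ∸ i)))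
    ≡⟨ sumTo-cong (suc m) term ⟩
  sumTo (suc m) (λ i → A i * geom A (suc m ∸ i)) ∎
  where
  term : ∀ i → i ≤ suc m → A i * sumTo m (λ j → pow A j (suc m ∸ i)) ≡ A i * geom A (suc m ∸ i)
  term zero    _ rewrite A₀≡0 = refl
  term (suc i) _ = cong (A (suc i) *_)
    (sumTo-truncate (m ∸ i) m _ (m∸n≤m m i) (λ j m∸i<j _ → pow-vanishes A A₀≡0 j (m ∸ i) m∸i<j))

⊛-identityʳ : ∀ (B : Series) n → (B ⊛ one) n ≡ B n
⊛-identityʳ B n = begin-equality
  sumTo n (λ i → B i * one (n ∸ i)) ≡⟨ sumTo-last n _ (λ i i<n → off-diagonal i (m<n⇒0<n∸m i<n)) ⟩
  B n * one (n ∸ n)                 ≡⟨ cong (λ t → B n * one t) (n∸n≡0 n) ⟩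
  B n * 1                           ≡⟨ *-identityʳ (B n) ⟩
  B n                               ∎
  where
  off-diagonal : ∀ i → 0 < n ∸ i → B i * one (n ∸ i) ≡ 0
  off-diagonal i 0<n∸i with n ∸ i
  ... | suc _ = *-zeroʳ (B i)

⊛-assoc-comm : ∀ (A B H : Series) n → (B ⊛ (A ⊛ H)) n ≡ (A ⊛ (B ⊛ H)) n
⊛-assoc-comm A B H n = begin-equality
  sumTo n (λ i → B i * sumTo (n ∸ i) (λ j → A j * H (n ∸ i ∸ j)))
    ≡⟨ sumTo-cong n (λ i _ → sumTo-*ˡ (n ∸ i) (B i) _) ⟨
  triangle n (λ i j → B i * (A j * H (n ∸ i ∸ j)))
    ≡⟨ triangle-transpose n _ ⟩
  triangle n (λ j i → B i * (A j * H (n ∸ i ∸ j)))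
    ≡⟨ sumTo-cong n (λ j _ → sumTo-cong (n ∸ j) (λ i _ → swap i j)) ⟩
  triangle n (λ j i → A j * (B i * H (n ∸ j ∸ i)))
    ≡⟨ sumTo-cong n (λ j _ → sumTo-*ˡ (n ∸ j) (A j) _) ⟩
  sumTo n (λ j → A j * sumTo (n ∸ j) (λ i → B i * H (n ∸ j ∸ i))) ∎
  where
  swap : ∀ i j → B i * (A j * H (n ∸ i ∸ j)) ≡ A j * (B i * H (n ∸ j ∸ i))
  swap i j = begin-equality
    B i * (A j * H (n ∸ i ∸ j)) ≡⟨ *-assoc (B i) _ _ ⟨
    B i * A j * H (n ∸ i ∸ j)   ≡⟨ cong₂ _*_ (*-comm (B i) (A j)) (cong H (∸-exchange n i j)) ⟩
    A j * B i * H (n ∸ j ∸ i)   ≡⟨ *-assoc (A j) _ _ ⟩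
    A j * (B i * H (n ∸ j ∸ i)) ∎
    where
    ∸-exchange : ∀ n i j → n ∸ i ∸ j ≡ n ∸ j ∸ i
    ∸-exchange n i j = trans (∸-+-assoc n i j) (trans (cong (n ∸_) (+-comm i j)) (sym (∸-+-assoc n j i)))

⊛-geom-unfold : ∀ (A B : Series) → A 0 ≡ 0 → ∀ n →
                (B ⊛ geom A) n ≡ (B ⊕ (A ⊛ (B ⊛ geom A))) n
⊛-geom-unfold A B A₀≡0 n = begin-equality
  sumTo n (λ i → B i * geom A (n ∸ i))
    ≡⟨ sumTo-cong n (λ i _ → trans (cong (B i *_) (geom-unfold A A₀≡0 (n ∸ i))) (*-distribˡ-+ (B i) _ _)) ⟩
  sumTo n (λ i → B i * one (n ∸ i) + B i * (A ⊛ geom A) (n ∸ i))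
    ≡⟨ sumTo-distrib-+ n _ _ ⟩
  (B ⊛ one) n + (B ⊛ (A ⊛ geom A)) n
    ≡⟨ cong₂ _+_ (⊛-identityʳ B n) (⊛-assoc-comm A B (geom A) n) ⟩
  B n + (A ⊛ (B ⊛ geom A)) n ∎

positivePart : Series → Series
positivePart f zero    = 0
positivePart f (suc j) = f (suc j)

G-coeff-0 : ∀ r → G r 0 ≡ 1
G-coeff-0 zero          = refl
G-coeff-0 (suc zero)    = refl
G-coeff-0 (suc (suc r)) = refl

G-coeff-1 : ∀ r → G r 1 ≡ 0
G-coeff-1 zero          = refl
G-coeff-1 (suc zero)    = refl
G-coeff-1 (suc (suc r)) = refl

G-recurrence : ∀ r n → G (2 + r) (2 + n) ≡
               G (suc r) n + sumTo n (λ i → G r i * positivePart (G (2 + r)) (n ∸ i))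
G-recurrence r n = begin-equality
  Y (2 + n)
    ≡⟨ ⊛-geom-unfold A B refl (2 + n) ⟩
  G (suc r) n + (A ⊛ Y) (2 + n)
    ≡⟨ cong (G (suc r) n +_) (trans (sumTo-unfoldˡ (suc n) _) (sumTo-unfoldˡ n _)) ⟩
  G (suc r) n + sumTo n (λ i → G r i * Y (n ∸ i))
    ≡⟨ cong (G (suc r) n +_) (sumTo-cong n (λ i _ → cong (G r i *_) (Y≡positivePart (n ∸ i)))) ⟩
  G (suc r) n + sumTo n (λ i → G r i * positivePart (G (2 + r)) (n ∸ i)) ∎
  where
  A B Y : Series
  A = shift2 (G r)
  B = shift2 (G (suc r))
  Y = B ⊛ geom A
  Y≡positivePart : ∀ t → Y t ≡ positivePart (G (2 + r)) t
  Y≡positivePart zero    = refl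
  Y≡positivePart (suc t) = refl

at-++ˡ : ∀ (u v : List ℕ) i → i < length u → at (u ++ v) i ≡ at u i
at-++ˡ (x ∷ u) v zero    _         = refl
at-++ˡ (x ∷ u) v (suc i) (s≤s i<u) = at-++ˡ u v i i<u

at-++ʳ : ∀ (u v : List ℕ) i → at (u ++ v) (length u + i) ≡ at v i
at-++ʳ []      v i = refl
at-++ʳ (x ∷ u) v i = at-++ʳ u v i

at-++-middle : ∀ (u v : List ℕ) x → at (u ++ x ∷ v) (length u) ≡ x
at-++-middle u v x = trans (cong (at (u ++ x ∷ v)) (sym (+-identityʳ (length u)))) (at-++ʳ u (x ∷ v) 0)

at-∈ : ∀ (u : List ℕ) i → i < length u → at u i ∈ u
at-∈ (x ∷ u) zero    _         = here refl
at-∈ (x ∷ u) (suc i) (s≤s i<u) = there (at-∈ u i i<u)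

∈⇒at : ∀ {x} (u : List ℕ) → x ∈ u → Σ ℕ λ i → i < length u × at u i ≡ x
∈⇒at (y ∷ u) (here refl) = 0 , s≤s z≤n , refl
∈⇒at (y ∷ u) (there x∈u) with i , i<u , uᵢ≡x ← ∈⇒at u x∈u = suc i , s≤s i<u , uᵢ≡x

at-∈-++ˡ : ∀ (u v : List ℕ) i → i < length u → at (u ++ v) i ∈ u
at-∈-++ˡ u v i i<u = subst (_∈ u) (sym (at-++ˡ u v i i<u)) (at-∈ u i i<u)

at-∈-++ʳ : ∀ (u v : List ℕ) i → length u ≤ i → i < length (u ++ v) → at (u ++ v) i ∈ v
at-∈-++ʳ u v i u≤i i<uv = subst (_∈ v) (sym uvᵢ≡vⱼ) (at-∈ v (i ∸ length u) j<v)
  where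
  uvᵢ≡vⱼ : at (u ++ v) i ≡ at v (i ∸ length u)
  uvᵢ≡vⱼ = trans (cong (at (u ++ v)) (sym (m+[n∸m]≡n u≤i))) (at-++ʳ u v (i ∸ length u))
  j<v : i ∸ length u < length v
  j<v = subst (i ∸ length u <_) (m+n∸m≡n (length u) (length v))
              (∸-monoˡ-< (subst (i <_) (length-++ u) i<uv) u≤i)

⇔<-subst : ∀ {P : Set} {a b a′ b′ : ℕ} → a ≡ a′ → b ≡ b′ → P ⇔ (a < b) → P ⇔ (a′ < b′)
⇔<-subst refl refl P⇔a<b = P⇔a<b

Occurrence-++⁻ˡ : ∀ p (u v : List ℕ) ι → Occurrence p (u ++ v) ι →
                  (∀ a → a < len p → ι a < length u) → Occurrence p u ι
Occurrence-++⁻ˡ p u v ι (mono , _ , adjacent , iso) inside =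
  mono , inside , adjacent ,
  λ a b a<p b<p → ⇔<-subst (at-++ˡ u v (ι a) (inside a a<p)) (at-++ˡ u v (ι b) (inside b b<p)) (iso a b a<p b<p)

Occurrence-++⁻ʳ : ∀ p (u v : List ℕ) ι → Occurrence p (u ++ v) ι →
                  (∀ a → a < len p → length u ≤ ι a) → Occurrence p v (λ a → ι a ∸ length u)
Occurrence-++⁻ʳ p u v ι (mono , inside , adjacent , iso) outside =
  (λ a b a<b b<p → ∸-monoˡ-< (mono a b a<b b<p) (outside a (<-trans a<b b<p))) ,
  (λ a a<p → subst (ι a ∸ length u <_) (m+n∸m≡n (length u) (length v))
                   (∸-monoˡ-< (subst (ι a <_) (length-++ u) (inside a a<p)) (outside a a<p))) ,
  (λ a 1+a<p adj → trans (cong (_∸ length u) (adjacent a 1+a<p adj))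
                         (+-∸-assoc 1 (outside a (<-trans (n<1+n a) 1+a<p)))) ,
  λ a b a<p b<p → ⇔<-subst (shift a a<p) (shift b b<p) (iso a b a<p b<p)
  where
  shift : ∀ a → a < len p → at (u ++ v) (ι a) ≡ at v (ι a ∸ length u)
  shift a a<p = trans (cong (at (u ++ v)) (sym (m+[n∸m]≡n (outside a a<p)))) (at-++ʳ u v (ι a ∸ length u))

Occurrence-++⁺ˡ : ∀ p (u v : List ℕ) ι → Occurrence p u ι → Occurrence p (u ++ v) ι
Occurrence-++⁺ˡ p u v ι (mono , inside , adjacent , iso) =
  mono ,
  (λ a a<p → subst (ι a <_) (sym (length-++ u)) (≤-trans (inside a a<p) (m≤m+n (length u) (length v)))) ,
  adjacent ,
  λ a b a<p b<p → ⇔<-subst (sym (at-++ˡ u v (ι a) (inside a a<p))) (sym (at-++ˡ u v (ι b) (inside b b<p)))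
                           (iso a b a<p b<p)

Occurrence-++⁺ʳ : ∀ p (u v : List ℕ) ι → Occurrence p v ι → Occurrence p (u ++ v) (λ a → length u + ι a)
Occurrence-++⁺ʳ p u v ι (mono , inside , adjacent , iso) =
  (λ a b a<b b<p → +-monoʳ-< (length u) (mono a b a<b b<p)) ,
  (λ a a<p → subst (length u + ι a <_) (sym (length-++ u)) (+-monoʳ-< (length u) (inside a a<p))) ,
  (λ a 1+a<p adj → trans (cong (length u +_) (adjacent a 1+a<p adj)) (+-suc (length u) (ι a))) ,
  λ a b a<p b<p → ⇔<-subst (sym (at-++ʳ u v (ι a))) (sym (at-++ʳ u v (ι b))) (iso a b a<p b<p)

Occurrence-< : ∀ p π ι → Occurrence p π ι → ∀ a b → a < len p → b < len p →
               val p a < val p b → at π (ι a) < at π (ι b)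
Occurrence-< p π ι (_ , _ , _ , iso) a b a<p b<p = Equivalence.to (iso a b a<p b<p)

both-true : ∀ {P Q : Set} → P → Q → P ⇔ Q
both-true p q = mk⇔ (λ _ → q) (λ _ → p)

both-false : ∀ {P Q : Set} → ¬ P → ¬ Q → P ⇔ Q
both-false ¬p ¬q = mk⇔ (λ p → ⊥-elim (¬p p)) (λ q → ⊥-elim (¬q q))

-- Both patterns of the theorem are pat213 A k for an adjacency A that is false from the
-- second gap on, which is all that the extension lemmas below use.
pat213 : (ℕ → Bool) → ℕ → GPattern
pat213 A k = record { len = k ; val = val213k ; adj = A }

Occurrence-truncate : ∀ A {j k} π ι → j ≤ k → Occurrence (pat213 A k) π ι → Occurrence (pat213 A j) π ι
Occurrence-truncate A π ι j≤k (mono , inside , adjacent , iso) =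
  (λ a b a<b b<j → mono a b a<b (<-≤-trans b<j j≤k)) ,
  (λ a a<j → inside a (<-≤-trans a<j j≤k)) ,
  (λ a 1+a<j → adjacent a (<-≤-trans 1+a<j j≤k)) ,
  λ a b a<j b<j → iso a b (<-≤-trans a<j j≤k) (<-≤-trans b<j j≤k)

Contains-truncate : ∀ A {j k} π → j ≤ k → Contains (pat213 A k) π → Contains (pat213 A j) π
Contains-truncate A π j≤k (ι , occ) = ι , Occurrence-truncate A π ι j≤k occ

position-gap : ∀ (ι : ℕ → ℕ) K → (∀ a b → a < b → b < K → ι a < ι b) →
               ∀ a d → a + d < K → ι a + d ≤ ι (a + d)
position-gap ι K mono a zero    _     = ≤-reflexive (trans (+-identityʳ (ι a)) (cong ι (sym (+-identityʳ a))))
position-gap ι K mono a (suc d) a+d<K = begin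
  ι a + suc d      ≡⟨ +-suc (ι a) d ⟩
  suc (ι a + d)    ≤⟨ s≤s (position-gap ι K mono a d (<-trans (≤-reflexive (sym (+-suc a d))) a+d<K)) ⟩
  suc (ι (a + d))  ≤⟨ mono (a + d) (a + suc d) (≤-reflexive (sym (+-suc a d))) a+d<K ⟩
  ι (a + suc d)    ∎

-- The last c letters of the occurrence need c distinct positions, so the first j lie in u.
Occurrence-dropTail : ∀ A j c (u w : List ℕ) ι → length w ≤ c →
                      Occurrence (pat213 A (j + c)) (u ++ w) ι → Occurrence (pat213 A j) u ι
Occurrence-dropTail A zero    c u w ι _ _ = (λ _ _ _ ()) , (λ _ ()) , (λ _ ()) , λ _ _ ()
Occurrence-dropTail A (suc j) c u w ι w≤c occ@(mono , inside , _ , _) =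
  Occurrence-++⁻ˡ (pat213 A (suc j)) u w ι
    (Occurrence-truncate A (u ++ w) ι (m≤m+n (suc j) c) occ) in-u
  where
  in-u : ∀ a → a < suc j → ι a < length u
  in-u a a<1+j = +-cancelʳ-< _ (ι a) (length u) (begin-strict
      ι a + length w        ≤⟨ +-monoʳ-≤ (ι a) (≤-trans w≤c (m≤n+m c (j ∸ a))) ⟩
      ι a + (j ∸ a + c)     ≤⟨ position-gap ι (suc j + c) mono a (j ∸ a + c) (≤-reflexive (cong suc a+[j∸a+c]≡j+c)) ⟩
      ι (a + (j ∸ a + c))   ≡⟨ cong ι a+[j∸a+c]≡j+c ⟩
      ι (j + c)             <⟨ inside (j + c) ≤-refl ⟩
      length (u ++ w)       ≡⟨ length-++ u ⟩
      length u + length w   ∎)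
    where
    a+[j∸a+c]≡j+c : a + (j ∸ a + c) ≡ j + c
    a+[j∸a+c]≡j+c = trans (sym (+-assoc a (j ∸ a) c)) (cong (_+ c) (m+[n∸m]≡n (≤-pred a<1+j)))

extendAt : (ℕ → ℕ) → ℕ → ℕ → ℕ → ℕ
extendAt ι j L a with a <? j
... | yes _ = ι a
... | no  _ = L

extendAt-< : ∀ ι j L a → a < j → extendAt ι j L a ≡ ι a
extendAt-< ι j L a a<j with a <? j
... | yes _   = refl
... | no  a≮j = ⊥-elim (a≮j a<j)

extendAt-≡ : ∀ ι j L → extendAt ι j L j ≡ L
extendAt-≡ ι j L with j <? j
... | yes j<j = ⊥-elim (<-irrefl refl j<j)
... | no  _   = refl

val213k-≤ : ∀ j b → 2 ≤ j → b < j → val213k b ≤ j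
val213k-≤ j zero          2≤j _   = 2≤j
val213k-≤ j (suc zero)    2≤j _   = ≤-trans (s≤s z≤n) 2≤j
val213k-≤ j (suc (suc b)) _   b<j = b<j

val213k-last : ∀ j → 2 ≤ j → val213k j ≡ suc j
val213k-last (suc (suc j)) _           = refl
val213k-last (suc zero)    (s≤s ())

Occurrence-extend : ∀ A → (∀ a → A (suc a) ≡ false) → ∀ j (u : List ℕ) t ι → 2 ≤ j → All (_< t) u →
                    Occurrence (pat213 A j) u ι →
                    Occurrence (pat213 A (suc j)) (u ++ t ∷ []) (extendAt ι j (length u))
Occurrence-extend A A-suc j u t ι 2≤j u<t (mono , inside , adjacent , iso) =
  mono′ , inside′ , adjacent′ , iso′
  where
  ι′ = extendAt ι j (length u)
  <1+j-view : ∀ {a} → a < suc j → a < j ⊎ a ≡ j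
  <1+j-view a<1+j = m≤n⇒m<n∨m≡n (≤-pred a<1+j)
  at-old : ∀ a → a < j → at (u ++ t ∷ []) (ι′ a) ≡ at u (ι a)
  at-old a a<j rewrite extendAt-< ι j (length u) a a<j = at-++ˡ u (t ∷ []) (ι a) (inside a a<j)
  at-new : at (u ++ t ∷ []) (ι′ j) ≡ t
  at-new rewrite extendAt-≡ ι j (length u) = at-++-middle u [] t
  old<t : ∀ a → a < j → at u (ι a) < t
  old<t a a<j = All.lookup u<t (at-∈ u (ι a) (inside a a<j))
  mono′ : ∀ a b → a < b → b < suc j → ι′ a < ι′ b
  mono′ a b a<b b<1+j with <1+j-view b<1+j
  ... | inj₁ b<j rewrite extendAt-< ι j (length u) a (<-trans a<b b<j) | extendAt-< ι j (length u) b b<j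
    = mono a b a<b b<j
  ... | inj₂ refl rewrite extendAt-< ι j (length u) a a<b | extendAt-≡ ι j (length u) = inside a a<b
  inside′ : ∀ a → a < suc j → ι′ a < length (u ++ t ∷ [])
  inside′ a a<1+j rewrite length-++ u {t ∷ []} | +-comm (length u) 1 with <1+j-view a<1+j
  ... | inj₁ a<j  rewrite extendAt-< ι j (length u) a a<j = ≤-trans (inside a a<j) (n≤1+n (length u))
  ... | inj₂ refl rewrite extendAt-≡ ι j (length u) = ≤-refl
  adjacent′ : ∀ a → suc a < suc j → A a ≡ true → ι′ (suc a) ≡ suc (ι′ a)
  adjacent′ a 1+a<1+j adj with <1+j-view 1+a<1+j
  ... | inj₁ 1+a<j rewrite extendAt-< ι j (length u) (suc a) 1+a<j | extendAt-< ι j (length u) a (<-trans (n<1+n a) 1+a<j)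
    = adjacent a 1+a<j adj
  adjacent′ zero    _ _   | inj₂ refl = ⊥-elim (<-irrefl refl 2≤j)
  adjacent′ (suc a) _ adj | inj₂ refl with () ← trans (sym (A-suc a)) adj
  iso′ : ∀ a b → a < suc j → b < suc j →
         (val213k a < val213k b) ⇔ (at (u ++ t ∷ []) (ι′ a) < at (u ++ t ∷ []) (ι′ b))
  iso′ a b a<1+j b<1+j with <1+j-view a<1+j | <1+j-view b<1+j
  ... | inj₁ a<j  | inj₁ b<j  = ⇔<-subst (sym (at-old a a<j)) (sym (at-old b b<j)) (iso a b a<j b<j)
  ... | inj₁ a<j  | inj₂ refl = ⇔<-subst (sym (at-old a a<j)) (sym at-new)
    (both-true (subst (val213k a <_) (sym (val213k-last b 2≤j)) (s≤s (val213k-≤ b a 2≤j a<j))) (old<t a a<j))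
  ... | inj₂ refl | inj₁ b<j  = ⇔<-subst (sym at-new) (sym (at-old b b<j))
    (both-false (λ lt → <-irrefl refl (<-≤-trans lt (subst (val213k b ≤_) (sym (val213k-last a 2≤j))
                                                              (m≤n⇒m≤1+n (val213k-≤ a b 2≤j b<j)))))
                (λ lt → <-asym lt (old<t b b<j)))
  ... | inj₂ refl | inj₂ refl = ⇔<-subst (sym at-new) (sym at-new) (both-false (<-irrefl refl) (<-irrefl refl))

descent⇒Contains-21 : ∀ A (π : List ℕ) i → suc i < length π → at π (suc i) < at π i →
                      Contains (pat213 A 2) π
descent⇒Contains-21 A π i 1+i<π descent = (λ a → a + i) , mono , inside , (λ _ _ _ → refl) , iso
  where
  mono : ∀ a b → a < b → b < 2 → a + i < b + i
  mono a b a<b _ = +-monoˡ-< i a<b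
  inside : ∀ a → a < 2 → a + i < length π
  inside zero       _ = <-trans (n<1+n i) 1+i<π
  inside (suc zero) _ = 1+i<π
  inside (suc (suc _)) (s≤s (s≤s ()))
  iso : ∀ a b → a < 2 → b < 2 → (val213k a < val213k b) ⇔ (at π (a + i) < at π (b + i))
  iso zero       zero       _ _ = both-false (<-irrefl refl) (<-irrefl refl)
  iso zero       (suc zero) _ _ = both-false (λ { (s≤s ()) }) (<-asym descent)
  iso (suc zero) zero       _ _ = both-true ≤-refl descent
  iso (suc zero) (suc zero) _ _ = both-false (<-irrefl refl) (<-irrefl refl)
  iso (suc (suc _)) _ (s≤s (s≤s ())) _
  iso _ (suc (suc _)) _ (s≤s (s≤s ()))

Contains-132 : ∀ (π : List ℕ) p₀ p₁ p₂ → p₀ < p₁ → p₁ < p₂ → p₂ < length π →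
               at π p₀ < at π p₂ → at π p₂ < at π p₁ → Contains pat1-3-2 π
Contains-132 π p₀ p₁ p₂ p₀<p₁ p₁<p₂ p₂<π π₀<π₂ π₂<π₁ = ι , mono , inside , (λ _ _ ()) , iso
  where
  ι : ℕ → ℕ
  ι zero          = p₀
  ι (suc zero)    = p₁
  ι (suc (suc _)) = p₂
  π₀<π₁ : at π p₀ < at π p₁
  π₀<π₁ = <-trans π₀<π₂ π₂<π₁
  mono : ∀ a b → a < b → b < 3 → ι a < ι b
  mono zero       (suc zero)       _ _ = p₀<p₁
  mono zero       (suc (suc zero)) _ _ = <-trans p₀<p₁ p₁<p₂
  mono (suc zero) (suc (suc zero)) _ _ = p₁<p₂
  mono (suc zero) (suc zero) (s≤s ()) _
  mono (suc (suc zero)) (suc (suc zero)) (s≤s (s≤s ())) _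
  mono (suc (suc _)) (suc zero) (s≤s ()) _
  mono (suc (suc (suc _))) (suc (suc zero)) (s≤s (s≤s ())) _
  mono _ (suc (suc (suc _))) _ (s≤s (s≤s (s≤s ())))
  inside : ∀ a → a < 3 → ι a < length π
  inside zero             _ = <-trans p₀<p₁ (<-trans p₁<p₂ p₂<π)
  inside (suc zero)       _ = <-trans p₁<p₂ p₂<π
  inside (suc (suc zero)) _ = p₂<π
  inside (suc (suc (suc _))) (s≤s (s≤s (s≤s ())))
  iso : ∀ a b → a < 3 → b < 3 → (val pat1-3-2 a < val pat1-3-2 b) ⇔ (at π (ι a) < at π (ι b))
  iso zero             zero             _ _ = both-false (<-irrefl refl) (<-irrefl refl)
  iso zero             (suc zero)       _ _ = both-true (s≤s (s≤s z≤n)) π₀<π₁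
  iso zero             (suc (suc zero)) _ _ = both-true (s≤s (s≤s z≤n)) π₀<π₂
  iso (suc zero)       zero             _ _ = both-false (λ { (s≤s ()) }) (<-asym π₀<π₁)
  iso (suc zero)       (suc zero)       _ _ = both-false (<-irrefl refl) (<-irrefl refl)
  iso (suc zero)       (suc (suc zero)) _ _ = both-false (λ { (s≤s (s≤s ())) }) (<-asym π₂<π₁)
  iso (suc (suc zero)) zero             _ _ = both-false (λ { (s≤s ()) }) (<-asym π₀<π₂)
  iso (suc (suc zero)) (suc zero)       _ _ = both-true (s≤s (s≤s (s≤s z≤n))) π₂<π₁
  iso (suc (suc zero)) (suc (suc zero)) _ _ = both-false (<-irrefl refl) (<-irrefl refl)
  iso (suc (suc (suc _))) _ (s≤s (s≤s (s≤s ()))) _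
  iso _ (suc (suc (suc _))) _ (s≤s (s≤s (s≤s ())))

Avoids-[] : ∀ p → 1 ≤ len p → Avoids p []
Avoids-[] p 1≤p (ι , _ , inside , _) = n≮0 (inside 0 1≤p)

module Occurrence132 (π : List ℕ) {ι : ℕ → ℕ} (occ : Occurrence pat1-3-2 π ι) where
  ι₀<ι₁ : ι 0 < ι 1
  ι₀<ι₁ = proj₁ occ 0 1 (s≤s z≤n) (s≤s (s≤s z≤n))
  ι₁<ι₂ : ι 1 < ι 2
  ι₁<ι₂ = proj₁ occ 1 2 (s≤s (s≤s z≤n)) ≤-refl
  ι₂<π : ι 2 < length π
  ι₂<π = proj₁ (proj₂ occ) 2 ≤-refl
  π₀<π₂ : at π (ι 0) < at π (ι 2)
  π₀<π₂ = Occurrence-< pat1-3-2 π ι occ 0 2 (s≤s z≤n) ≤-refl (s≤s (s≤s z≤n))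
  π₂<π₁ : at π (ι 2) < at π (ι 1)
  π₂<π₁ = Occurrence-< pat1-3-2 π ι occ 2 1 ≤-refl (s≤s (s≤s z≤n)) ≤-refl
  ι≤ι₂ : ∀ a → a < 3 → ι a ≤ ι 2
  ι≤ι₂ zero             _ = <⇒≤ (<-trans ι₀<ι₁ ι₁<ι₂)
  ι≤ι₂ (suc zero)       _ = <⇒≤ ι₁<ι₂
  ι≤ι₂ (suc (suc zero)) _ = ≤-refl
  ι≤ι₂ (suc (suc (suc _))) (s≤s (s≤s (s≤s ())))
  ι₀≤ι : ∀ a → a < 3 → ι 0 ≤ ι a
  ι₀≤ι zero             _ = ≤-refl
  ι₀≤ι (suc zero)       _ = <⇒≤ ι₀<ι₁
  ι₀≤ι (suc (suc zero)) _ = <⇒≤ (<-trans ι₀<ι₁ ι₁<ι₂)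
  ι₀≤ι (suc (suc (suc _))) (s≤s (s≤s (s≤s ())))

Avoids-132-++ : ∀ (u v : List ℕ) → Avoids pat1-3-2 u → Avoids pat1-3-2 v →
                (∀ {x y} → x ∈ u → y ∈ v → y < x) → Avoids pat1-3-2 (u ++ v)
Avoids-132-++ u v u-avoids v-avoids v<u (ι , occ) with ι 2 <? length u | ι 0 <? length u
... | yes ι₂<u | _ = u-avoids (ι , Occurrence-++⁻ˡ pat1-3-2 u v ι occ (λ a a<3 → ≤-<-trans (ι≤ι₂ a a<3) ι₂<u))
  where open Occurrence132 (u ++ v) occ
... | no ι₂≮u | yes ι₀<u =
  <-asym π₀<π₂ (v<u (at-∈-++ˡ u v (ι 0) ι₀<u) (at-∈-++ʳ u v (ι 2) (≮⇒≥ ι₂≮u) ι₂<π))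
  where open Occurrence132 (u ++ v) occ
... | no _ | no ι₀≮u = v-avoids (_ , Occurrence-++⁻ʳ pat1-3-2 u v ι occ (λ a a<3 → ≤-trans (≮⇒≥ ι₀≮u) (ι₀≤ι a a<3)))
  where open Occurrence132 (u ++ v) occ

Avoids-132-∷ʳ : ∀ (u : List ℕ) t → Avoids pat1-3-2 u → All (_< t) u → Avoids pat1-3-2 (u ++ t ∷ [])
Avoids-132-∷ʳ u t u-avoids u<t (ι , occ) with ι 2 <? length u
... | yes ι₂<u = u-avoids (ι , Occurrence-++⁻ˡ pat1-3-2 u (t ∷ []) ι occ (λ a a<3 → ≤-<-trans (ι≤ι₂ a a<3) ι₂<u))
  where open Occurrence132 (u ++ t ∷ []) occ
... | no ι₂≮u = <-asym π₂<π₁ (subst₂ _<_ (sym (at-++ˡ u (t ∷ []) (ι 1) ι₁<u)) (sym π₂≡t)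
                                        (All.lookup u<t (at-∈ u (ι 1) ι₁<u)))
  where
  open Occurrence132 (u ++ t ∷ []) occ
  ι₂≡u : ι 2 ≡ length u
  ι₂≡u = ≤-antisym (≤-pred (subst (ι 2 <_) (trans (length-++ u) (+-comm (length u) 1)) ι₂<π)) (≮⇒≥ ι₂≮u)
  ι₁<u : ι 1 < length u
  ι₁<u = subst (ι 1 <_) ι₂≡u ι₁<ι₂
  π₂≡t : at (u ++ t ∷ []) (ι 2) ≡ t
  π₂≡t = trans (cong (at (u ++ t ∷ [])) ι₂≡u) (at-++-middle u [] t)

Occurrence-213-first< : ∀ A k π ι → Occurrence (pat213 A k) π ι →
                        ∀ a → 2 ≤ a → a < k → at π (ι 0) < at π (ι a)
Occurrence-213-first< A k π ι occ (suc zero) (s≤s ()) _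
Occurrence-213-first< A k π ι occ (suc (suc a)) _ a<k =
  Occurrence-< (pat213 A k) π ι occ 0 (suc (suc a)) (≤-trans (s≤s z≤n) a<k) a<k (s≤s (s≤s (s≤s z≤n)))

Occurrence-first≤ : ∀ p π ι → Occurrence p π ι → ∀ a → a < len p → ι 0 ≤ ι a
Occurrence-first≤ p π ι occ zero    _   = ≤-refl
Occurrence-first≤ p π ι occ (suc a) a<p = <⇒≤ (proj₁ occ 0 (suc a) (s≤s z≤n) a<p)

Avoids-213-++ : ∀ A j c (α w β : List ℕ) → length w ≤ c → 3 ≤ j + c →
                Avoids (pat213 A j) α → Avoids (pat213 A (j + c)) β →
                (∀ {x y} → x ∈ α ++ w → y ∈ β → y < x) → Avoids (pat213 A (j + c)) ((α ++ w) ++ β)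
Avoids-213-++ A j c α w β w≤c 3≤k α-avoids β-avoids β<αw (ι , occ@(mono , inside , _ , _))
  with ι 0 <? length (α ++ w)
... | no ι₀≮αw = β-avoids (_ , Occurrence-++⁻ʳ (pat213 A (j + c)) (α ++ w) β ι occ
                                 (λ a a<k → ≤-trans (≮⇒≥ ι₀≮αw)
                                                    (Occurrence-first≤ (pat213 A (j + c)) ((α ++ w) ++ β) ι occ a a<k)))
... | yes ι₀<αw = α-avoids (ι , Occurrence-dropTail A j c α w ι w≤c
                                   (Occurrence-++⁻ˡ (pat213 A (j + c)) (α ++ w) β ι occ in-αw))
  where
  in-αw : ∀ a → a < j + c → ι a < length (α ++ w)
  in-αw zero                _   = ι₀<αw
  in-αw (suc zero)          _   = <-trans (mono 1 2 ≤-refl 3≤k) (in-αw 2 3≤k)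
  in-αw (suc (suc a)) a<k with ι (suc (suc a)) <? length (α ++ w)
  ... | yes ιₐ<αw = ιₐ<αw
  ... | no  ιₐ≮αw = ⊥-elim (<-asym (Occurrence-213-first< A (j + c) ((α ++ w) ++ β) ι occ (suc (suc a)) (s≤s (s≤s z≤n)) a<k)
                                   (β<αw (at-∈-++ˡ (α ++ w) β (ι 0) ι₀<αw)
                                         (at-∈-++ʳ (α ++ w) β (ι (suc (suc a))) (≮⇒≥ ιₐ≮αw) (inside (suc (suc a)) a<k))))

Avoids-213-++-tail : ∀ A j c (β w : List ℕ) → length w ≤ c →
                     Avoids (pat213 A j) β → Avoids (pat213 A (j + c)) (β ++ w)
Avoids-213-++-tail A j c β w w≤c β-avoids (ι , occ) = β-avoids (ι , Occurrence-dropTail A j c β w ι w≤c occ)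

Avoids-213-∷ : ∀ A j (v : List ℕ) M → 2 ≤ j → Avoids (pat213 A (suc j)) v → All (_< M) v →
               Avoids (pat213 A (suc j)) (M ∷ v)
Avoids-213-∷ A j v M 2≤j v-avoids v<M (ι , occ@(mono , inside , _ , _)) with ι 0 <? 1
... | no ι₀≮1 = v-avoids (_ , Occurrence-++⁻ʳ (pat213 A (suc j)) (M ∷ []) v ι occ
                               (λ a a<k → ≤-trans (≮⇒≥ ι₀≮1) (Occurrence-first≤ (pat213 A (suc j)) (M ∷ v) ι occ a a<k)))
... | yes ι₀<1 = <-asym (Occurrence-213-first< A (suc j) (M ∷ v) ι occ 2 ≤-refl (s≤s 2≤j))
                        (subst (at (M ∷ v) (ι 2) <_) (sym π₀≡M) (All.lookup v<M π₂∈v))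
  where
  π₀≡M : at (M ∷ v) (ι 0) ≡ M
  π₀≡M with here M≡π₀ ← at-∈-++ˡ (M ∷ []) v (ι 0) ι₀<1 = M≡π₀
  π₂∈v : at (M ∷ v) (ι 2) ∈ v
  π₂∈v = at-∈-++ʳ (M ∷ []) v (ι 2) (≤-trans (s≤s z≤n) (mono 0 2 (s≤s z≤n) (s≤s 2≤j))) (inside 2 (s≤s 2≤j))

Avoids-++⁻ˡ : ∀ p (u v : List ℕ) → Avoids p (u ++ v) → Avoids p u
Avoids-++⁻ˡ p u v avoids (ι , occ) = avoids (ι , Occurrence-++⁺ˡ p u v ι occ)

Avoids-++⁻ʳ : ∀ p (u v : List ℕ) → Avoids p (u ++ v) → Avoids p v
Avoids-++⁻ʳ p u v avoids (ι , occ) = avoids (_ , Occurrence-++⁺ʳ p u v ι occ)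

even-2+ : ∀ {a} → 2 ∣ a → 2 ∣ 2 + a
even-2+ = ∣m∣n⇒∣m+n (divides 1 refl)

even-2+⁻ : ∀ {a} → 2 ∣ 2 + a → 2 ∣ a
even-2+⁻ 2∣2+a = ∣m+n∣m⇒∣n 2∣2+a (divides 1 refl)

even⇒odd-suc : ∀ {a} → 2 ∣ a → ¬ 2 ∣ suc a
even⇒odd-suc {a} 2∣a 2∣1+a with () ← ∣1⇒≡1 (∣m+n∣m⇒∣n (subst (2 ∣_) (+-comm 1 a) 2∣1+a) 2∣a)

even∨even-suc : ∀ a → 2 ∣ a ⊎ 2 ∣ suc a
even∨even-suc zero    = inj₁ (2 ∣0)
even∨even-suc (suc a) with even∨even-suc a
... | inj₁ 2∣a   = inj₂ (even-2+ 2∣a)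
... | inj₂ 2∣1+a = inj₁ 2∣1+a

even∨odd : ∀ n → 2 ∣ n ⊎ Σ ℕ λ m → n ≡ suc m × 2 ∣ m
even∨odd zero    = inj₁ (2 ∣0)
even∨odd (suc m) with even∨even-suc m
... | inj₁ 2∣m   = inj₂ (m , refl , 2∣m)
... | inj₂ 2∣1+m = inj₁ 2∣1+m

DumontStep : ℕ → ℕ → Set
DumontStep x y = (2 ∣ x → y < x) × (¬ 2 ∣ x → x < y)

DumontAt : ℕ → List ℕ → Set
DumontAt x []      = ¬ 2 ∣ x
DumontAt x (y ∷ _) = DumontStep x y

Dumont : List ℕ → Set
Dumont []       = ⊤
Dumont (x ∷ xs) = DumontAt x xs × Dumont xs

IsDumont⇒Dumont : ∀ π → IsDumont π → Dumont π
IsDumont⇒Dumont []       _ = tt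
IsDumont⇒Dumont (x ∷ xs) D = first xs (D 0 (s≤s z≤n)) , IsDumont⇒Dumont xs D′
  where
  first : ∀ xs → (2 ∣ x → 1 < suc (length xs) × at (x ∷ xs) 1 < x)
               × (¬ 2 ∣ x → 1 ≡ suc (length xs) ⊎ (1 < suc (length xs) × x < at (x ∷ xs) 1)) →
          DumontAt x xs
  first []      (even , _)   = λ 2∣x → <-irrefl refl (proj₁ (even 2∣x))
  first (y ∷ _) (even , odd) = (λ 2∣x → proj₂ (even 2∣x)) , λ ¬2∣x → [ (λ ()) , proj₂ ]′ (odd ¬2∣x)
  D′ : IsDumont xs
  D′ i i<xs with even , odd ← D (suc i) (s≤s i<xs) =
    (λ 2∣xᵢ → map₁ ≤-pred (even 2∣xᵢ)) , λ ¬2∣xᵢ → ⊎-map suc-injective (map₁ ≤-pred) (odd ¬2∣xᵢ)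

Dumont⇒IsDumont : ∀ π → Dumont π → IsDumont π
Dumont⇒IsDumont (x ∷ [])     (¬2∣x , _)            zero _ = (λ 2∣x → ⊥-elim (¬2∣x 2∣x)) , λ _ → inj₁ refl
Dumont⇒IsDumont (x ∷ y ∷ ys) ((even , odd) , _)    zero _ =
  (λ 2∣x → s≤s (s≤s z≤n) , even 2∣x) , λ ¬2∣x → inj₂ (s≤s (s≤s z≤n) , odd ¬2∣x)
Dumont⇒IsDumont (x ∷ xs)     (_ , D) (suc i) (s≤s i<xs) with even , odd ← Dumont⇒IsDumont xs D i i<xs =
  (λ 2∣xᵢ → map₁ s≤s (even 2∣xᵢ)) , λ ¬2∣xᵢ → ⊎-map (cong suc) (map₁ s≤s) (odd ¬2∣xᵢ)

Dumont-++⁻ʳ : ∀ (u v : List ℕ) → Dumont (u ++ v) → Dumont v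
Dumont-++⁻ʳ []      v D       = D
Dumont-++⁻ʳ (x ∷ u) v (_ , D) = Dumont-++⁻ʳ u v D

Dumont-at : ∀ (u : List ℕ) y w → Dumont (u ++ y ∷ w) → DumontAt y w
Dumont-at []      y w (Dy , _) = Dy
Dumont-at (x ∷ u) y w (_ , D)  = Dumont-at u y w D

Dumont-++⁻ˡ : ∀ (u : List ℕ) y w → Dumont (u ++ y ∷ w) → All (_< y) u → Dumont u
Dumont-++⁻ˡ []           y w _ _ = tt
Dumont-++⁻ˡ (x ∷ [])     y w ((even , _) , _) (x<y ∷ []) = (λ 2∣x → <-asym x<y (even 2∣x)) , tt
Dumont-++⁻ˡ (x ∷ x′ ∷ u) y w (Dx , D) (_ ∷ u<y) = Dx , Dumont-++⁻ˡ (x′ ∷ u) y w D u<y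

Dumont-++⁺ : ∀ (u : List ℕ) y w → Dumont u → Dumont (y ∷ w) → All (_< y) u → Dumont (u ++ y ∷ w)
Dumont-++⁺ []           y w _  D _ = D
Dumont-++⁺ (x ∷ [])     y w (¬2∣x , _) D (x<y ∷ []) = ((λ 2∣x → ⊥-elim (¬2∣x 2∣x)) , (λ _ → x<y)) , D
Dumont-++⁺ (x ∷ x′ ∷ u) y w (Dx , Du) D (_ ∷ u<y) = Dx , Dumont-++⁺ (x′ ∷ u) y w Du D u<y

All-remove : ∀ {P : ℕ → Set} (p : List ℕ) {x s} → All P (p ++ x ∷ s) → All P (p ++ s)
All-remove p P-pxs = All.++⁺ (All.++⁻ˡ p P-pxs) (All.tail (All.++⁻ʳ p P-pxs))

Unique-remove : ∀ (p : List ℕ) {x s} → Unique (p ++ x ∷ s) → Unique (p ++ s)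
Unique-remove []      (_ ∷ u)         = u
Unique-remove (y ∷ p) (y∉ps ∷ u) = All-remove p y∉ps ∷ Unique-remove p u

Unique-≢ : ∀ (p : List ℕ) {x s} → Unique (p ++ x ∷ s) → All (_≢ x) (p ++ s)
Unique-≢ []      (x∉s ∷ _)  = All.map (λ x≢z z≡x → x≢z (sym z≡x)) x∉s
Unique-≢ (y ∷ p) (y∉ps ∷ u) = All.lookup y∉ps (∈-++⁺ʳ p (here refl)) ∷ Unique-≢ p u

Unique-++-≢ : ∀ (u v : List ℕ) {x y} → Unique (u ++ v) → x ∈ u → y ∈ v → x ≢ y
Unique-++-≢ (z ∷ u) v (z∉uv ∷ _) (here refl) y∈v = All.lookup z∉uv (∈-++⁺ʳ u y∈v)
Unique-++-≢ (z ∷ u) v (_ ∷ uv)   (there x∈u) y∈v = Unique-++-≢ u v uv x∈u y∈v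

Unique-++⁻ : ∀ (u v : List ℕ) → Unique (u ++ v) → Unique u × Unique v
Unique-++⁻ []      v uv           = [] , uv
Unique-++⁻ (z ∷ u) v (z∉uv ∷ uv) = (All.++⁻ˡ u z∉uv ∷ proj₁ (Unique-++⁻ u v uv)) , proj₂ (Unique-++⁻ u v uv)

InInterval : ℕ → ℕ → ℕ → Set
InInterval lo hi v = lo < v × v ≤ hi

InInterval-shrink : ∀ {lo hi v} → v ≢ suc hi → InInterval lo (suc hi) v → InInterval lo hi v
InInterval-shrink v≢1+hi (lo<v , v≤1+hi) with m≤n⇒m<n∨m≡n v≤1+hi
... | inj₁ v<1+hi = lo<v , ≤-pred v<1+hi
... | inj₂ v≡1+hi = ⊥-elim (v≢1+hi v≡1+hi)

InInterval-shrinkˡ : ∀ {lo hi v} → v ≢ suc lo → InInterval lo hi v → InInterval (suc lo) hi v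
InInterval-shrinkˡ v≢1+lo (lo<v , v≤hi) with m≤n⇒m<n∨m≡n lo<v
... | inj₁ 1+lo<v = 1+lo<v , v≤hi
... | inj₂ 1+lo≡v = ⊥-elim (v≢1+lo (sym 1+lo≡v))

Unique-InInterval-length : ∀ hi lo (xs : List ℕ) → Unique xs → All (InInterval lo hi) xs → length xs ≤ hi ∸ lo
Unique-InInterval-length zero    lo []       _ _ = z≤n
Unique-InInterval-length zero    lo (v ∷ _)  _ ((lo<v , v≤0) ∷ _) = ⊥-elim (n≮0 (<-≤-trans lo<v v≤0))
Unique-InInterval-length (suc hi) lo xs u xs∈ with suc hi ∈? xs
... | no  1+hi∉xs =
  ≤-trans (Unique-InInterval-length hi lo xs u (All.tabulate (λ v∈xs → shrink v∈xs (All.lookup xs∈ v∈xs))))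
          (∸-monoˡ-≤ lo (n≤1+n hi))
  where
  shrink : ∀ {v} → v ∈ xs → InInterval lo (suc hi) v → InInterval lo hi v
  shrink v∈xs = InInterval-shrink (λ { refl → 1+hi∉xs v∈xs })
... | yes 1+hi∈xs with p , s , refl ← ∈-∃++ 1+hi∈xs = begin
  length (p ++ suc hi ∷ s)   ≡⟨ length-++ p ⟩
  length p + suc (length s)  ≡⟨ +-suc (length p) _ ⟩
  suc (length p + length s)  ≡⟨ cong suc (length-++ p) ⟨
  suc (length (p ++ s))      ≤⟨ s≤s (Unique-InInterval-length hi lo (p ++ s) (Unique-remove p u)
                                     (All.zipWith (λ (v≢1+hi , v∈) → InInterval-shrink v≢1+hi v∈)
                                                  (Unique-≢ p u , All-remove p xs∈))) ⟩
  suc (hi ∸ lo)              ≡⟨ +-∸-assoc 1 lo≤hi ⟨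
  suc hi ∸ lo                ∎
  where
  lo≤hi : lo ≤ hi
  lo≤hi = ≤-pred (proj₁ (All.lookup xs∈ (∈-++⁺ʳ p (here refl))))

Unique-InInterval-length′ : ∀ hi lo (xs : List ℕ) → lo ≤ hi → Unique xs → All (InInterval lo hi) xs →
                            lo + length xs ≤ hi
Unique-InInterval-length′ hi lo xs lo≤hi u xs∈ =
  ≤-trans (+-monoʳ-≤ lo (Unique-InInterval-length hi lo xs u xs∈)) (≤-reflexive (m+[n∸m]≡n lo≤hi))

Unique-InInterval-max∈ : ∀ hi lo (xs : List ℕ) → Unique xs → All (InInterval lo (suc hi)) xs →
                         hi ∸ lo < length xs → suc hi ∈ xs
Unique-InInterval-max∈ hi lo xs u xs∈ long with suc hi ∈? xs
... | yes 1+hi∈xs = 1+hi∈xs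
... | no  1+hi∉xs = ⊥-elim (<-irrefl refl (<-≤-trans long (Unique-InInterval-length hi lo xs u
                      (All.tabulate (λ v∈xs → InInterval-shrink (λ { refl → 1+hi∉xs v∈xs }) (All.lookup xs∈ v∈xs))))))

Unique-InInterval-min∈ : ∀ hi lo (xs : List ℕ) → Unique xs → All (InInterval lo hi) xs →
                         hi ∸ suc lo < length xs → suc lo ∈ xs
Unique-InInterval-min∈ hi lo xs u xs∈ long with suc lo ∈? xs
... | yes 1+lo∈xs = 1+lo∈xs
... | no  1+lo∉xs = ⊥-elim (<-irrefl refl (<-≤-trans long (Unique-InInterval-length hi (suc lo) xs u
                      (All.tabulate (λ v∈xs → InInterval-shrinkˡ (λ { refl → 1+lo∉xs v∈xs }) (All.lookup xs∈ v∈xs))))))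

length-concatMap-applyUpTo : ∀ {A : Set} (g : ℕ → List A) f n →
  length (concatMap g (applyUpTo f (suc n))) ≡ sumTo n (λ i → length (g (f i)))
length-concatMap-applyUpTo g f zero    = trans (length-++ (g (f 0))) (+-identityʳ _)
length-concatMap-applyUpTo g f (suc n) = begin-equality
  length (g (f 0) ++ concatMap g (applyUpTo (λ i → f (suc i)) (suc n)))
    ≡⟨ length-++ (g (f 0)) ⟩
  length (g (f 0)) + length (concatMap g (applyUpTo (λ i → f (suc i)) (suc n)))
    ≡⟨ cong (length (g (f 0)) +_) (length-concatMap-applyUpTo g (λ i → f (suc i)) n) ⟩
  length (g (f 0)) + sumTo n (λ i → length (g (f (suc i))))
    ≡⟨ sumTo-unfoldˡ n (λ i → length (g (f i))) ⟨
  sumTo (suc n) (λ i → length (g (f i))) ∎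

length-concatMap-const : ∀ {A B : Set} (g : A → List B) c xs → (∀ x → length (g x) ≡ c) →
                         length (concatMap g xs) ≡ length xs * c
length-concatMap-const g c []       _         = refl
length-concatMap-const g c (x ∷ xs) length≡c = begin-equality
  length (g x ++ concatMap g xs)           ≡⟨ length-++ (g x) ⟩
  length (g x) + length (concatMap g xs)   ≡⟨ cong₂ _+_ (length≡c x) (length-concatMap-const g c xs length≡c) ⟩
  c + length xs * c                        ∎

Unique-concatMap⁺ : ∀ {A B : Set} (g : A → List B) xs → Unique xs → (∀ {x} → x ∈ xs → Unique (g x)) →
                    (∀ {x y z} → x ∈ xs → y ∈ xs → z ∈ g x → z ∈ g y → x ≡ y) → Unique (concatMap g xs)
Unique-concatMap⁺ g []       _             _        _        = []
Unique-concatMap⁺ g (x ∷ xs) (x∉xs ∷ u) unique-g disjoint =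
  Unique.++⁺ (unique-g (here refl))
             (Unique-concatMap⁺ g xs u (λ y∈xs → unique-g (there y∈xs)) (λ y∈ y′∈ → disjoint (there y∈) (there y′∈)))
             λ (z∈gx , z∈rest) → let (y , y∈xs , z∈gy) = find (∈-concatMap⁻ g z∈rest)
                                  in All.lookup x∉xs y∈xs (disjoint (here refl) (there y∈xs) z∈gx z∈gy)

∈-concatMap-map⁻ : ∀ {A B C : Set} (h : A → B → C) xs ys {z} → z ∈ concatMap (λ x → map (h x) ys) xs →
                   Σ A λ x → Σ B λ y → x ∈ xs × y ∈ ys × z ≡ h x y
∈-concatMap-map⁻ h xs ys z∈
  with x , x∈ , z∈ₓ ← find (∈-concatMap⁻ (λ x → map (h x) ys) z∈)
  with y , y∈ , refl ← ∈-map⁻ (h x) z∈ₓ = x , y , x∈ , y∈ , refl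

∈-concatMap-map⁺ : ∀ {A B C : Set} (h : A → B → C) {xs ys x y} → x ∈ xs → y ∈ ys →
                   h x y ∈ concatMap (λ x → map (h x) ys) xs
∈-concatMap-map⁺ h {ys = ys} x∈ y∈ = ∈-concatMap⁺ (λ x → map (h x) ys) (lose x∈ (∈-map⁺ (h _) y∈))

enclose : ℕ → List ℕ → List ℕ
enclose T β = suc (suc T) ∷ (β ++ suc T ∷ [])

splice : ℕ → List ℕ → List ℕ → List ℕ
splice T α β = α ++ suc T ∷ suc (suc T) ∷ β

-- For even lo and n, blocks f r lo n lists the Dumont arrangements of lo+1, ..., lo+n that avoid
-- 1-3-2 and pat213 A (1 + r), for every A as in pat213; the fuel f ≥ n only makes the recursion
-- structural.
mutual
  blocks : ℕ → ℕ → ℕ → ℕ → List (List ℕ)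
  blocks f       r             lo zero          = [] ∷ []
  blocks f       r             lo (suc zero)    = []
  blocks zero    r             lo (suc (suc n)) = []
  blocks (suc f) zero          lo (suc (suc n)) = []
  blocks (suc f) (suc zero)    lo (suc (suc n)) = []
  blocks (suc f) (suc (suc r)) lo (suc (suc n)) =
    map (enclose (lo + n)) (blocks f (suc r) lo n) ++ concatMap (splicings f r lo n) (upTo (suc n))

  blocks⁺ : ℕ → ℕ → ℕ → ℕ → List (List ℕ)
  blocks⁺ f r lo zero    = []
  blocks⁺ f r lo (suc j) = blocks f r lo (suc j)

  splicings : ℕ → ℕ → ℕ → ℕ → ℕ → List (List ℕ)
  splicings f r lo n i =
    concatMap (λ α → map (splice (lo + n) α) (blocks⁺ f (2 + r) lo (n ∸ i))) (blocks f r (lo + (n ∸ i)) i)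

length-blocks : ∀ f n → n ≤ f → ∀ r lo → length (blocks f r lo n) ≡ G r n
length-blocks f       zero          _ r lo = sym (G-coeff-0 r)
length-blocks (suc f) (suc zero)    _ r lo = sym (G-coeff-1 r)
length-blocks (suc f) (suc (suc n)) _ zero lo = refl
length-blocks (suc f) (suc (suc n)) _ (suc zero) lo = refl
length-blocks (suc f) (suc (suc n)) 2+n≤1+f (suc (suc r)) lo = begin-equality
  length (map (enclose (lo + n)) (blocks f (suc r) lo n) ++ concatMap (splicings f r lo n) (upTo (suc n)))
    ≡⟨ length-++ (map (enclose (lo + n)) (blocks f (suc r) lo n)) ⟩
  length (map (enclose (lo + n)) (blocks f (suc r) lo n)) + length (concatMap (splicings f r lo n) (upTo (suc n)))
    ≡⟨ cong₂ _+_ (trans (length-map _ (blocks f (suc r) lo n)) (length-blocks f n n≤f (suc r) lo))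
                 (length-concatMap-applyUpTo (splicings f r lo n) (λ i → i) n) ⟩
  G (suc r) n + sumTo n (λ i → length (splicings f r lo n i))
    ≡⟨ cong (G (suc r) n +_) (sumTo-cong n length-splicings) ⟩
  G (suc r) n + sumTo n (λ i → G r i * positivePart (G (2 + r)) (n ∸ i))
    ≡⟨ G-recurrence r n ⟨
  G (2 + r) (2 + n) ∎
  where
  n≤f : n ≤ f
  n≤f = ≤-pred (≤-trans (n≤1+n (suc n)) 2+n≤1+f)
  length-blocks⁺ : ∀ j → j ≤ f → length (blocks⁺ f (2 + r) lo j) ≡ positivePart (G (2 + r)) j
  length-blocks⁺ zero    _   = refl
  length-blocks⁺ (suc j) j<f = length-blocks f (suc j) j<f (2 + r) lo
  length-splicings : ∀ i → i ≤ n → length (splicings f r lo n i) ≡ G r i * positivePart (G (2 + r)) (n ∸ i)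
  length-splicings i i≤n = begin-equality
    length (splicings f r lo n i)
      ≡⟨ length-concatMap-const _ _ (blocks f r (lo + (n ∸ i)) i)
                                (λ α → length-map (splice (lo + n) α) (blocks⁺ f (2 + r) lo (n ∸ i))) ⟩
    length (blocks f r (lo + (n ∸ i)) i) * length (blocks⁺ f (2 + r) lo (n ∸ i))
      ≡⟨ cong₂ _*_ (length-blocks f i (≤-trans i≤n n≤f) r (lo + (n ∸ i)))
                   (length-blocks⁺ (n ∸ i) (≤-trans (m∸n≤m n i) n≤f)) ⟩
    G r i * positivePart (G (2 + r)) (n ∸ i) ∎

∈-splicings⁻ : ∀ f r lo n i {z} → z ∈ splicings f r lo n i →
               Σ (List ℕ) λ α → Σ (List ℕ) λ β → α ∈ blocks f r (lo + (n ∸ i)) i ×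
                 β ∈ blocks⁺ f (2 + r) lo (n ∸ i) × z ≡ splice (lo + n) α β
∈-splicings⁻ f r lo n i =
  ∈-concatMap-map⁻ (splice (lo + n)) (blocks f r (lo + (n ∸ i)) i) (blocks⁺ f (2 + r) lo (n ∸ i))

data BlocksView (f r lo n : ℕ) : List ℕ → Set where
  enclosed : ∀ {β} → β ∈ blocks f (suc r) lo n → BlocksView f r lo n (enclose (lo + n) β)
  spliced  : ∀ {α β} i b → i + suc b ≡ n → α ∈ blocks f r (lo + suc b) i → β ∈ blocks f (2 + r) lo (suc b) →
             BlocksView f r lo n (splice (lo + n) α β)

blocks-view : ∀ f r lo n {π} → π ∈ blocks (suc f) (2 + r) lo (2 + n) → BlocksView f r lo n π
blocks-view f r lo n π∈ with ∈-++⁻ (map (enclose (lo + n)) (blocks f (suc r) lo n)) π∈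
... | inj₁ π∈enclosed with β , β∈ , refl ← ∈-map⁻ (enclose (lo + n)) π∈enclosed = enclosed β∈
... | inj₂ π∈spliced
  with i , i∈ , π∈ᵢ ← find (∈-concatMap⁻ (splicings f r lo n) π∈spliced)
  with α , β , α∈ , β∈ , refl ← ∈-splicings⁻ f r lo n i π∈ᵢ
  with n ∸ i | m+[n∸m]≡n {i} {n} (≤-pred (∈-upTo⁻ i∈))
... | suc b | i+1+b≡n = spliced i b i+1+b≡n α∈ β∈

enclosed-∈ : ∀ f r lo n {β} → β ∈ blocks f (suc r) lo n → enclose (lo + n) β ∈ blocks (suc f) (2 + r) lo (2 + n)
enclosed-∈ f r lo n β∈ = ∈-++⁺ˡ (∈-map⁺ (enclose (lo + n)) β∈)

spliced-∈ : ∀ f r lo n {α β} i b → i + suc b ≡ n → α ∈ blocks f r (lo + suc b) i → β ∈ blocks f (2 + r) lo (suc b) →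
            splice (lo + n) α β ∈ blocks (suc f) (2 + r) lo (2 + n)
spliced-∈ f r lo n {α} {β} i b refl α∈ β∈ =
  ∈-++⁺ʳ (map (enclose (lo + n)) (blocks f (suc r) lo n))
    (∈-concatMap⁺ (splicings f r lo n) (lose (∈-upTo⁺ (s≤s (m≤m+n i (suc b))))
      (subst (λ j → splice (lo + n) α β ∈ concatMap (λ α → map (splice (lo + n) α) (blocks⁺ f (2 + r) lo j))
                                                     (blocks f r (lo + j) i))
             (sym (m+n∸m≡n i (suc b)))
             (∈-concatMap-map⁺ (splice (lo + n)) α∈ β∈))))

OnInterval : ℕ → ℕ → List ℕ → Set
OnInterval lo n π = length π ≡ n × All (InInterval lo (lo + n)) π

InInterval-weaken : ∀ {lo lo′ hi hi′ v} → lo′ ≤ lo → hi ≤ hi′ → InInterval lo hi v → InInterval lo′ hi′ v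
InInterval-weaken lo′≤lo hi≤hi′ (lo<v , v≤hi) = ≤-<-trans lo′≤lo lo<v , ≤-trans v≤hi hi≤hi′

+-2+ : ∀ lo n → lo + (2 + n) ≡ 2 + (lo + n)
+-2+ lo n = trans (+-suc lo (suc n)) (cong suc (+-suc lo n))

InInterval-2+ : ∀ {lo n x} → InInterval lo (lo + (2 + n)) x → InInterval lo (2 + (lo + n)) x
InInterval-2+ {lo} {n} {x} = subst (λ hi → InInterval lo hi x) (+-2+ lo n)

top-InInterval : ∀ lo n → InInterval lo (lo + (2 + n)) (2 + (lo + n))
top-InInterval lo n = s≤s (≤-trans (m≤m+n lo n) (n≤1+n _)) , ≤-reflexive (sym (+-2+ lo n))

second-InInterval : ∀ lo n → InInterval lo (lo + (2 + n)) (suc (lo + n))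
second-InInterval lo n = s≤s (m≤m+n lo n) , ≤-trans (n≤1+n _) (≤-reflexive (sym (+-2+ lo n)))

below-second : ∀ {lo n v} → InInterval lo (lo + n) v → InInterval lo (lo + (2 + n)) v
below-second {lo} {n} = InInterval-weaken ≤-refl (+-monoʳ-≤ lo (≤-trans (n≤1+n n) (n≤1+n _)))

enclose-OnInterval : ∀ lo n β → OnInterval lo n β → OnInterval lo (2 + n) (enclose (lo + n) β)
enclose-OnInterval lo n β (β-length , β∈) =
  cong suc (trans (length-++ β) (trans (cong (_+ 1) β-length) (+-comm n 1))) ,
  top-InInterval lo n ∷ All.++⁺ (All.map below-second β∈) (second-InInterval lo n ∷ [])

splice-OnInterval : ∀ lo n i b α β → i + suc b ≡ n → OnInterval (lo + suc b) i α → OnInterval lo (suc b) β →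
                    OnInterval lo (2 + n) (splice (lo + n) α β)
splice-OnInterval lo n i b α β i+1+b≡n (α-length , α∈) (β-length , β∈) =
  splice-length ,
  All.++⁺ (All.map (λ v∈ → below-second (InInterval-weaken (m≤m+n lo (suc b)) (≤-reflexive α-top≡) v∈)) α∈)
          (second-InInterval lo n ∷ top-InInterval lo n ∷
           All.map (λ v∈ → below-second (InInterval-weaken ≤-refl (+-monoʳ-≤ lo 1+b≤n) v∈)) β∈)
  where
  α-top≡ : lo + suc b + i ≡ lo + n
  α-top≡ = trans (+-assoc lo (suc b) i) (cong (lo +_) (trans (+-comm (suc b) i) i+1+b≡n))
  1+b≤n : suc b ≤ n
  1+b≤n = ≤-trans (m≤n+m (suc b) i) (≤-reflexive i+1+b≡n)
  splice-length : length (splice (lo + n) α β) ≡ 2 + n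
  splice-length = begin-equality
    length (α ++ _ ∷ _ ∷ β)       ≡⟨ length-++ α ⟩
    length α + (2 + length β)     ≡⟨ cong₂ (λ x y → x + (2 + y)) α-length β-length ⟩
    i + (2 + suc b)               ≡⟨ +-2+ i (suc b) ⟩
    2 + (i + suc b)               ≡⟨ cong (2 +_) i+1+b≡n ⟩
    2 + n                         ∎

blocks-OnInterval : ∀ f r lo n {π} → π ∈ blocks f r lo n → OnInterval lo n π
blocks-OnInterval f r lo zero (here refl) = refl , []
blocks-OnInterval (suc f) (suc (suc r)) lo (suc (suc n)) π∈ with blocks-view f r lo n π∈
... | enclosed {β} β∈ = enclose-OnInterval lo n β (blocks-OnInterval f (suc r) lo n β∈)
... | spliced {α} {β} i b i+1+b≡n α∈ β∈ =
  splice-OnInterval lo n i b α β i+1+b≡n (blocks-OnInterval f r (lo + suc b) i α∈)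
                                         (blocks-OnInterval f (2 + r) lo (suc b) β∈)

++-∷-cancel-below : ∀ (a b : List ℕ) {x c d} → All (_< x) a → All (_< x) b → a ++ x ∷ c ≡ b ++ x ∷ d →
                    a ≡ b × c ≡ d
++-∷-cancel-below []      []      _           _           refl = refl , refl
++-∷-cancel-below []      (y ∷ b) _           (y<x ∷ _)   eq with refl ← ∷-injectiveˡ eq = ⊥-elim (<-irrefl refl y<x)
++-∷-cancel-below (y ∷ a) []      (y<x ∷ _)   _           eq with refl ← ∷-injectiveˡ eq = ⊥-elim (<-irrefl refl y<x)
++-∷-cancel-below (y ∷ a) (_ ∷ b) (_ ∷ a<x)   (_ ∷ b<x)   eq with refl , eq′ ← ∷-injective eq
  with refl , c≡d ← ++-∷-cancel-below a b a<x b<x eq′ = refl , c≡d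

enclose-injective : ∀ T {β β′} → enclose T β ≡ enclose T β′ → β ≡ β′
enclose-injective T {β} {β′} eq = ∷ʳ-injectiveˡ β β′ (∷-injectiveʳ eq)

splice-injectiveʳ : ∀ T α {β β′} → splice T α β ≡ splice T α β′ → β ≡ β′
splice-injectiveʳ T α eq = ∷-injectiveʳ (∷-injectiveʳ (++-cancelˡ α _ _ eq))

splice-injectiveˡ : ∀ T {α α′ β β′} → All (_< suc T) α → All (_< suc T) α′ →
                    splice T α β ≡ splice T α′ β′ → α ≡ α′
splice-injectiveˡ T {α} {α′} α<T α′<T eq = proj₁ (++-∷-cancel-below α α′ α<T α′<T eq)

enclose≢splice : ∀ T {α β β′} → All (_< suc T) α → enclose T β ≢ splice T α β′
enclose≢splice T {[]}    _           eq = <-irrefl (sym (∷-injectiveˡ eq)) ≤-refl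
enclose≢splice T {x ∷ α} (x<1+T ∷ _) eq = <-irrefl (sym (∷-injectiveˡ eq)) (≤-trans x<1+T (n≤1+n _))

blocks-below : ∀ f r lo n i {α} → i ≤ n → α ∈ blocks f r (lo + (n ∸ i)) i → All (_< suc (lo + n)) α
blocks-below f r lo n i i≤n α∈ =
  All.map (λ (_ , v≤) → s≤s (≤-trans v≤ (≤-reflexive top≡))) (proj₂ (blocks-OnInterval f r (lo + (n ∸ i)) i α∈))
  where
  top≡ : lo + (n ∸ i) + i ≡ lo + n
  top≡ = trans (+-assoc lo (n ∸ i) i) (cong (lo +_) (m∸n+n≡m i≤n))

splicings-disjoint : ∀ f r lo n {i i′ z} → i ≤ n → i′ ≤ n →
                     z ∈ splicings f r lo n i → z ∈ splicings f r lo n i′ → i ≡ i′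
splicings-disjoint f r lo n {i} {i′} i≤n i′≤n z∈ z∈′
  with α , _ , α∈ , _ , z≡ ← ∈-splicings⁻ f r lo n i z∈
  with α′ , _ , α′∈ , _ , z≡′ ← ∈-splicings⁻ f r lo n i′ z∈′
  with refl ← splice-injectiveˡ (lo + n) (blocks-below f r lo n i i≤n α∈) (blocks-below f r lo n i′ i′≤n α′∈)
                                (trans (sym z≡) z≡′)
  = trans (sym (proj₁ (blocks-OnInterval f r _ i α∈))) (proj₁ (blocks-OnInterval f r _ i′ α′∈))

enclosed-splicings-disjoint : ∀ f r lo n {i z} → i ≤ n → z ∈ map (enclose (lo + n)) (blocks f (suc r) lo n) →
                              z ∈ splicings f r lo n i → ⊥
enclosed-splicings-disjoint f r lo n {i} i≤n z∈enclosed z∈spliced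
  with β , _ , z≡ ← ∈-map⁻ (enclose (lo + n)) z∈enclosed
  with α , _ , α∈ , _ , z≡′ ← ∈-splicings⁻ f r lo n i z∈spliced
  = enclose≢splice (lo + n) (blocks-below f r lo n i i≤n α∈) (trans (sym z≡) z≡′)

mutual
  blocks-Unique : ∀ f r lo n → Unique (blocks f r lo n)
  blocks-Unique f       r             lo zero          = [] ∷ []
  blocks-Unique f       r             lo (suc zero)    = []
  blocks-Unique zero    r             lo (suc (suc n)) = []
  blocks-Unique (suc f) zero          lo (suc (suc n)) = []
  blocks-Unique (suc f) (suc zero)    lo (suc (suc n)) = []
  blocks-Unique (suc f) (suc (suc r)) lo (suc (suc n)) =
    Unique.++⁺ (Unique.map⁺ (enclose-injective (lo + n)) (blocks-Unique f (suc r) lo n))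
               (Unique-concatMap⁺ (splicings f r lo n) (upTo (suc n)) (Unique.upTo⁺ (suc n))
                  (λ i∈ → splicings-Unique f r lo n (≤-pred (∈-upTo⁻ i∈)))
                  (λ i∈ i′∈ → splicings-disjoint f r lo n (≤-pred (∈-upTo⁻ i∈)) (≤-pred (∈-upTo⁻ i′∈))))
               λ (z∈enclosed , z∈spliced) →
                 let (i , i∈ , z∈ᵢ) = find (∈-concatMap⁻ (splicings f r lo n) z∈spliced)
                 in enclosed-splicings-disjoint f r lo n (≤-pred (∈-upTo⁻ i∈)) z∈enclosed z∈ᵢ

  splicings-Unique : ∀ f r lo n {i} → i ≤ n → Unique (splicings f r lo n i)
  splicings-Unique f r lo n {i} i≤n =
    Unique-concatMap⁺ _ (blocks f r (lo + (n ∸ i)) i) (blocks-Unique f r (lo + (n ∸ i)) i)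
      (λ {α} _ → Unique.map⁺ (splice-injectiveʳ (lo + n) α) (blocks⁺-Unique f (2 + r) lo (n ∸ i)))
      λ {α} {α′} α∈ α′∈ z∈ z∈′ →
        let (β , _ , z≡) = ∈-map⁻ (splice (lo + n) α) z∈ ; (β′ , _ , z≡′) = ∈-map⁻ (splice (lo + n) α′) z∈′
        in splice-injectiveˡ (lo + n) (blocks-below f r lo n i i≤n α∈) (blocks-below f r lo n i i≤n α′∈)
                             (trans (sym z≡) z≡′)

  blocks⁺-Unique : ∀ f r lo j → Unique (blocks⁺ f r lo j)
  blocks⁺-Unique f r lo zero    = []
  blocks⁺-Unique f r lo (suc j) = blocks-Unique f r lo (suc j)

record Block (lo n : ℕ) (π : List ℕ) : Set where
  constructor block
  field
    onInterval : OnInterval lo n π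
    unique     : Unique π
    even       : 2 ∣ n
    dumont     : Dumont π
    avoids132  : Avoids pat1-3-2 π

Block-[] : ∀ lo → Block lo 0 []
Block-[] lo = block (refl , []) [] (2 ∣0) tt (Avoids-[] pat1-3-2 (s≤s z≤n))

enclose-Block : ∀ lo n β → 2 ∣ lo → Block lo n β → Block lo (2 + n) (enclose (lo + n) β)
enclose-Block lo n β 2∣lo (block β-on β-unique 2∣n β-dumont β-avoids) =
  block (enclose-OnInterval lo n β β-on) unique (even-2+ 2∣n) (M-step β β<M , dumont) avoids
  where
  T = lo + n
  2∣T : 2 ∣ T
  2∣T = ∣m∣n⇒∣m+n 2∣lo 2∣n
  β<M₁ : All (_< suc T) β
  β<M₁ = All.map (λ (_ , v≤T) → s≤s v≤T) (proj₂ β-on)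
  β<M : All (_< 2 + T) (β ++ suc T ∷ [])
  β<M = All.++⁺ (All.map (λ v<M₁ → ≤-trans v<M₁ (n≤1+n _)) β<M₁) (≤-refl ∷ [])
  unique : Unique (enclose T β)
  unique = All.map (λ v<M M≡v → <-irrefl (sym M≡v) v<M) β<M ∷
           Unique.++⁺ β-unique ([] ∷ []) (λ { (v∈β , here refl) → <-irrefl refl (All.lookup β<M₁ v∈β) })
  M-step : ∀ β → All (_< 2 + T) (β ++ suc T ∷ []) → DumontAt (2 + T) (β ++ suc T ∷ [])
  M-step []      _         = (λ _ → ≤-refl) , λ M-odd → ⊥-elim (M-odd (even-2+ 2∣T))
  M-step (y ∷ _) (y<M ∷ _) = (λ _ → y<M)    , λ M-odd → ⊥-elim (M-odd (even-2+ 2∣T))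
  dumont : Dumont (β ++ suc T ∷ [])
  dumont = Dumont-++⁺ β (suc T) [] β-dumont (even⇒odd-suc 2∣T , tt) β<M₁
  avoids : Avoids pat1-3-2 (enclose T β)
  avoids = Avoids-132-++ (2 + T ∷ []) (β ++ suc T ∷ [])
             (Avoids-132-∷ʳ [] (2 + T) (Avoids-[] pat1-3-2 (s≤s z≤n)) [])
             (Avoids-132-∷ʳ β (suc T) β-avoids β<M₁)
             (λ { (here refl) v∈ → All.lookup β<M v∈ })

module SpliceBounds {lo n i b : ℕ} (i+1+b≡n : i + suc b ≡ n) {α β : List ℕ}
                    (α-on : OnInterval (lo + suc b) i α) (β-on : OnInterval lo (suc b) β) where
  α<M₁ : All (_< suc (lo + n)) α
  α<M₁ = All.map (λ (_ , v≤) → s≤s (≤-trans v≤ (≤-reflexive α-top≡))) (proj₂ α-on)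
    where
    α-top≡ : lo + suc b + i ≡ lo + n
    α-top≡ = trans (+-assoc lo (suc b) i) (cong (lo +_) (trans (+-comm (suc b) i) i+1+b≡n))

  β<M₁ : All (_< suc (lo + n)) β
  β<M₁ = All.map (λ (_ , v≤) → s≤s (≤-trans v≤ (+-monoʳ-≤ lo (≤-trans (m≤n+m (suc b) i) (≤-reflexive i+1+b≡n)))))
                 (proj₂ β-on)

  β<α : ∀ {x y} → x ∈ α → y ∈ β → y < x
  β<α x∈ y∈ = ≤-<-trans (proj₂ (All.lookup (proj₂ β-on) y∈)) (proj₁ (All.lookup (proj₂ α-on) x∈))

module _ (T : ℕ) {α β : List ℕ} (α<M₁ : All (_< suc T) α) (β<M₁ : All (_< suc T) β)
         (β<α : ∀ {x y} → x ∈ α → y ∈ β → y < x) where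
  private
    <M₁⇒<M : ∀ {v} → v < suc T → v < 2 + T
    <M₁⇒<M v<M₁ = ≤-trans v<M₁ (n≤1+n _)

  β<splice-prefix : ∀ {x y} → x ∈ α ++ suc T ∷ 2 + T ∷ [] → y ∈ β → y < x
  β<splice-prefix x∈ y∈ with ∈-++⁻ α x∈
  ... | inj₁ x∈α                  = β<α x∈α y∈
  ... | inj₂ (here refl)          = All.lookup β<M₁ y∈
  ... | inj₂ (there (here refl))  = <M₁⇒<M (All.lookup β<M₁ y∈)

  splice-Unique : Unique α → Unique β → Unique (splice T α β)
  splice-Unique α-unique β-unique =
    Unique.++⁺ α-unique
      (((λ M₁≡M → <-irrefl M₁≡M (n<1+n (suc T))) ∷ All.map (λ v<M₁ M₁≡v → <-irrefl (sym M₁≡v) v<M₁) β<M₁) ∷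
       All.map (λ v<M₁ M≡v → <-irrefl (sym M≡v) (<M₁⇒<M v<M₁)) β<M₁ ∷ β-unique)
      λ { (v∈α , here refl)         → <-irrefl refl (All.lookup α<M₁ v∈α)
        ; (v∈α , there (here refl)) → <-irrefl refl (<M₁⇒<M (All.lookup α<M₁ v∈α))
        ; (v∈α , there (there v∈β)) → <-irrefl refl (β<α v∈α v∈β) }

  splice-Avoids-132 : Avoids pat1-3-2 α → Avoids pat1-3-2 β → Avoids pat1-3-2 (splice T α β)
  splice-Avoids-132 α-avoids β-avoids =
    subst (Avoids pat1-3-2) (++-assoc α (suc T ∷ 2 + T ∷ []) β)
      (Avoids-132-++ (α ++ suc T ∷ 2 + T ∷ []) β
        (subst (Avoids pat1-3-2) (++-assoc α (suc T ∷ []) (2 + T ∷ []))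
          (Avoids-132-∷ʳ (α ++ suc T ∷ []) (2 + T) (Avoids-132-∷ʳ α (suc T) α-avoids α<M₁)
                         (All.++⁺ (All.map <M₁⇒<M α<M₁) (≤-refl ∷ []))))
        β-avoids β<splice-prefix)

splice-Block : ∀ lo n i b α β → i + suc b ≡ n → 2 ∣ lo → Block (lo + suc b) i α → Block lo (suc b) β →
               Block lo (2 + n) (splice (lo + n) α β)
splice-Block lo n i b α β i+1+b≡n 2∣lo (block α-on α-unique 2∣i α-dumont α-avoids)
                                       (block β-on β-unique 2∣1+b β-dumont β-avoids) =
  block (splice-OnInterval lo n i b α β i+1+b≡n α-on β-on)
        (splice-Unique T α<M₁ β<M₁ β<α α-unique β-unique) (even-2+ 2∣n)
        (Dumont-++⁺ α (suc T) (2 + T ∷ β) α-dumont (M₁-step , M-step β (proj₁ β-on) β<M₁ , β-dumont) α<M₁)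
        (splice-Avoids-132 T α<M₁ β<M₁ β<α α-avoids β-avoids)
  where
  open SpliceBounds i+1+b≡n α-on β-on
  T = lo + n
  2∣n : 2 ∣ n
  2∣n = subst (2 ∣_) i+1+b≡n (∣m∣n⇒∣m+n 2∣i 2∣1+b)
  2∣T : 2 ∣ T
  2∣T = ∣m∣n⇒∣m+n 2∣lo 2∣n
  M₁-step : DumontStep (suc T) (2 + T)
  M₁-step = (λ M₁-even → ⊥-elim (even⇒odd-suc 2∣T M₁-even)) , (λ _ → ≤-refl)
  M-step : ∀ β → length β ≡ suc b → All (_< suc T) β → DumontAt (2 + T) β
  M-step (y ∷ _) _ (y<M₁ ∷ _) = (λ _ → ≤-trans y<M₁ (n≤1+n _)) , λ M-odd → ⊥-elim (M-odd (even-2+ 2∣T))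

blocks-Block : ∀ f r lo n {π} → 2 ∣ lo → π ∈ blocks f r lo n → Block lo n π
blocks-Block f r lo zero 2∣lo (here refl) = Block-[] lo
blocks-Block (suc f) (suc (suc r)) lo (suc (suc n)) 2∣lo π∈ with blocks-view f r lo n π∈
... | enclosed {β} β∈ = enclose-Block lo n β 2∣lo (blocks-Block f (suc r) lo n 2∣lo β∈)
... | spliced {α} {β} i b i+1+b≡n α∈ β∈ =
  splice-Block lo n i b α β i+1+b≡n 2∣lo (blocks-Block f r (lo + suc b) i (∣m∣n⇒∣m+n 2∣lo (Block.even β-block)) α∈) β-block
  where
  β-block : Block lo (suc b) β
  β-block = blocks-Block f (2 + r) lo (suc b) 2∣lo β∈

blocks-avoid : ∀ A f r lo n {π} → π ∈ blocks f r lo n → Avoids (pat213 A (suc r)) π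
blocks-avoid A f r lo zero (here refl) = Avoids-[] (pat213 A (suc r)) (s≤s z≤n)
blocks-avoid A (suc f) (suc (suc r)) lo (suc (suc n)) π∈ with blocks-view f r lo n π∈
... | enclosed {β} β∈ =
  Avoids-213-∷ A (2 + r) (β ++ suc T ∷ []) (2 + T) (s≤s (s≤s z≤n))
    (subst (λ k → Avoids (pat213 A k) (β ++ suc T ∷ [])) (+-comm (2 + r) 1)
      (Avoids-213-++-tail A (2 + r) 1 β (suc T ∷ []) ≤-refl (blocks-avoid A f (suc r) lo n β∈)))
    (All.++⁺ (All.map (λ (_ , v≤T) → s≤s (≤-trans v≤T (n≤1+n T))) (proj₂ (blocks-OnInterval f (suc r) lo n β∈)))
             (≤-refl ∷ []))
  where T = lo + n
... | spliced {α} {β} i b i+1+b≡n α∈ β∈ =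
  subst₂ (λ k π → Avoids (pat213 A k) π) (+-comm (suc r) 2) (++-assoc α (suc T ∷ 2 + T ∷ []) β)
    (Avoids-213-++ A (suc r) 2 α (suc T ∷ 2 + T ∷ []) β ≤-refl
                   (≤-trans (s≤s (s≤s (s≤s z≤n))) (≤-reflexive (+-comm 2 (suc r))))
      (blocks-avoid A f r (lo + suc b) i α∈)
      (subst (λ k → Avoids (pat213 A k) β) (+-comm 2 (suc r)) (blocks-avoid A f (2 + r) lo (suc b) β∈))
      (β<splice-prefix T α<M₁ β<M₁ β<α))
  where
  T = lo + n
  open SpliceBounds i+1+b≡n (blocks-OnInterval f r (lo + suc b) i α∈) (blocks-OnInterval f (2 + r) lo (suc b) β∈)

Avoids-132-split : ∀ (u v : List ℕ) M → Unique (u ++ M ∷ v) → Avoids pat1-3-2 (u ++ M ∷ v) → All (_< M) v →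
                   ∀ {x y} → x ∈ u → y ∈ v → y < x
Avoids-132-split u v M unique avoids v<M {x} {y} x∈u y∈v with x <? y
... | no  x≮y = ≤∧≢⇒< (≮⇒≥ x≮y) (λ y≡x → Unique-++-≢ u (M ∷ v) unique x∈u (there y∈v) (sym y≡x))
... | yes x<y with i , i<u , uᵢ≡x ← ∈⇒at u x∈u | j , j<v , vⱼ≡y ← ∈⇒at v y∈v =
  ⊥-elim (avoids (Contains-132 (u ++ M ∷ v) i (length u) (length u + suc j) i<u (m<m+n (length u) (s≤s z≤n))
    (subst (length u + suc j <_) (sym (length-++ u)) (+-monoʳ-< (length u) (s≤s j<v)))
    (subst₂ _<_ (sym (trans (at-++ˡ u (M ∷ v) i i<u) uᵢ≡x)) (sym at-y) x<y)
    (subst₂ _<_ (sym at-y) (sym (at-++-middle u v M)) (All.lookup v<M y∈v))))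
  where
  at-y : at (u ++ M ∷ v) (length u + suc j) ≡ y
  at-y = trans (at-++ʳ u (M ∷ v) (suc j)) vⱼ≡y

Block-bounded : ∀ {lo n π} → Block lo (2 + n) π → All (InInterval lo (2 + (lo + n))) π
Block-bounded π-block = All.map InInterval-2+ (proj₂ (Block.onInterval π-block))

Block-max∈ : ∀ lo m {π} → Block lo (suc m) π → suc (lo + m) ∈ π
Block-max∈ lo m {π} (block (π-length , π-bounded) π-unique _ _ _) =
  Unique-InInterval-max∈ (lo + m) lo π π-unique (subst (λ hi → All (InInterval lo hi) π) (+-suc lo m) π-bounded)
    (subst (_< length π) (sym (m+n∸m≡n lo m)) (≤-reflexive (sym π-length)))

module AroundMax {lo n : ℕ} (α β : List ℕ) (π-block : Block lo (2 + n) (α ++ 2 + (lo + n) ∷ β)) where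
  T = lo + n

  αβ-bounded : All (InInterval lo (suc T)) (α ++ β)
  αβ-bounded = All.zipWith (λ (v≢M , v∈) → InInterval-shrink v≢M v∈)
                 (Unique-≢ α (Block.unique π-block) , All-remove α (Block-bounded π-block))

  α-bounded : All (InInterval lo (suc T)) α
  α-bounded = All.++⁻ˡ α αβ-bounded

  β-bounded : All (InInterval lo (suc T)) β
  β-bounded = All.++⁻ʳ α αβ-bounded

  β<α : ∀ {x y} → x ∈ α → y ∈ β → y < x
  β<α = Avoids-132-split α β (2 + T) (Block.unique π-block) (Block.avoids132 π-block)
                         (All.map (λ (_ , v≤) → s≤s v≤) β-bounded)

  second∈ : suc T ∈ α ++ β
  second∈ = Unique-InInterval-max∈ T lo (α ++ β) (Unique-remove α (Block.unique π-block)) αβ-bounded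
              (subst (_< length (α ++ β)) (sym (m+n∸m≡n lo n)) (≤-reflexive (sym αβ-length)))
    where
    αβ-length : length (α ++ β) ≡ suc n
    αβ-length = suc-injective (begin-equality
      suc (length (α ++ β))       ≡⟨ cong suc (length-++ α) ⟩
      suc (length α + length β)   ≡⟨ +-suc (length α) (length β) ⟨
      length α + suc (length β)   ≡⟨ length-++ α ⟨
      length (α ++ 2 + T ∷ β)     ≡⟨ proj₁ (Block.onInterval π-block) ⟩
      2 + n                       ∎)

enclose-Block⁻ : ∀ lo n β → Block lo (2 + n) (enclose (lo + n) β) → Block lo n β
enclose-Block⁻ lo n β (block (π-length , π-bounded) (M∉ ∷ βM₁-unique) 2∣2+n (_ , βM₁-dumont) π-avoids) =
  block (β-length , All.tabulate β-bounded) (proj₁ (Unique-++⁻ β (suc T ∷ []) βM₁-unique)) (even-2+⁻ 2∣2+n)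
        (Dumont-++⁻ˡ β (suc T) [] βM₁-dumont (All.tabulate (λ x∈ → s≤s (proj₂ (β-bounded x∈)))))
        (Avoids-++⁻ˡ pat1-3-2 β (suc T ∷ []) (Avoids-++⁻ʳ pat1-3-2 (2 + T ∷ []) (β ++ suc T ∷ []) π-avoids))
  where
  T = lo + n
  β-length : length β ≡ n
  β-length = +-cancelʳ-≡ 1 (length β) n (trans (trans (sym (length-++ β)) (suc-injective π-length)) (+-comm 1 n))
  β-bounded : ∀ {x} → x ∈ β → InInterval lo T x
  β-bounded x∈ = InInterval-shrink (Unique-++-≢ β (suc T ∷ []) βM₁-unique x∈ (here refl))
                   (InInterval-shrink (λ x≡M → All.lookup M∉ (∈-++⁺ˡ x∈) (sym x≡M))
                     (InInterval-2+ (All.lookup π-bounded (there (∈-++⁺ˡ x∈)))))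

Dumont-min-odd : ∀ c (u : List ℕ) → Dumont u → All (c <_) u → suc c ∈ u → ¬ 2 ∣ suc c
Dumont-min-odd c u u-dumont c<u 1+c∈u with p , s , refl ← ∈-∃++ 1+c∈u
  with s | Dumont-at p (suc c) s u-dumont | All.++⁻ʳ p c<u
... | []    | 1+c-odd     | _            = 1+c-odd
... | z ∷ _ | (even , _)  | _ ∷ c<z ∷ _  = λ 2∣1+c → <-irrefl refl (≤-trans c<z (≤-pred (even 2∣1+c)))

module SpliceInverse {lo n : ℕ} (α : List ℕ) (y : ℕ) (β′ : List ℕ) (2∣lo : 2 ∣ lo)
                     (π-block : Block lo (2 + n) (splice (lo + n) α (y ∷ β′))) where
  T = lo + n
  β = y ∷ β′
  b = length β′
  i = length α

  lengths : i + suc b ≡ n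
  lengths = +-cancelˡ-≡ 2 _ _ (begin-equality
    2 + (i + suc b)                ≡⟨ +-2+ i (suc b) ⟨
    i + (2 + suc b)                ≡⟨ length-++ α ⟨
    length (splice T α β)          ≡⟨ proj₁ (Block.onInterval π-block) ⟩
    2 + n                          ∎)

  private
    parts = Unique-++⁻ α (suc T ∷ 2 + T ∷ β) (Block.unique π-block)
    αM₁ = α ++ suc T ∷ []
    αM₁-assoc : αM₁ ++ 2 + T ∷ β ≡ splice T α β
    αM₁-assoc = ++-assoc α (suc T ∷ []) (2 + T ∷ β)

  α-unique : Unique α
  α-unique = proj₁ parts

  β-unique : Unique β
  β-unique with _ ∷ _ ∷ β-unique ← proj₂ parts = β-unique

  below-T : ∀ {x} → x ≢ suc T → x ≢ 2 + T → InInterval lo (lo + (2 + n)) x → InInterval lo T x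
  below-T x≢M₁ x≢M x∈ = InInterval-shrink x≢M₁ (InInterval-shrink x≢M (InInterval-2+ x∈))

  α-in : ∀ {x} → x ∈ α → InInterval lo T x
  α-in x∈ = below-T (Unique-++-≢ α _ (Block.unique π-block) x∈ (here refl))
                    (Unique-++-≢ α _ (Block.unique π-block) x∈ (there (here refl)))
                    (All.lookup (proj₂ (Block.onInterval π-block)) (∈-++⁺ˡ x∈))

  β-in : ∀ {z} → z ∈ β → InInterval lo T z
  β-in z∈ with M₁∉ ∷ M∉ ∷ _ ← proj₂ parts =
    below-T (λ z≡M₁ → All.lookup M₁∉ (there z∈) (sym z≡M₁)) (λ z≡M → All.lookup M∉ z∈ (sym z≡M))
            (All.lookup (proj₂ (Block.onInterval π-block)) (∈-++⁺ʳ α (there (there z∈))))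

  β<αM₁ : ∀ {x z} → x ∈ αM₁ → z ∈ β → z < x
  β<αM₁ = Avoids-132-split αM₁ β (2 + T) (subst Unique (sym αM₁-assoc) (Block.unique π-block))
            (subst (Avoids pat1-3-2) (sym αM₁-assoc) (Block.avoids132 π-block))
            (All.tabulate (λ z∈ → s≤s (m≤n⇒m≤1+n (proj₂ (β-in z∈)))))

  -- Pigeonhole: α ++ [1 + T] are i + 1 distinct values in (z, 1 + T].
  β-bounded : ∀ {z} → z ∈ β → InInterval lo (lo + suc b) z
  β-bounded {z} z∈ = proj₁ (β-in z∈) , +-cancelʳ-≤ i z (lo + suc b) (≤-pred (begin
    suc (z + i)           ≡⟨ +-suc z i ⟨
    z + suc i             ≡⟨ cong (z +_) (trans (+-comm 1 i) (sym (length-++ α))) ⟩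
    z + length αM₁        ≤⟨ Unique-InInterval-length′ (suc T) z αM₁ (m≤n⇒m≤1+n (proj₂ (β-in z∈)))
                               (proj₁ (Unique-++⁻ αM₁ (2 + T ∷ β) (subst Unique (sym αM₁-assoc) (Block.unique π-block))))
                               (All.tabulate (λ x∈ → β<αM₁ x∈ z∈ , αM₁≤M₁ x∈)) ⟩
    suc (lo + n)          ≡⟨ cong (λ t → suc (lo + t)) (sym lengths) ⟩
    suc (lo + (i + suc b)) ≡⟨ cong suc (trans (cong (lo +_) (+-comm i (suc b))) (sym (+-assoc lo (suc b) i))) ⟩
    suc (lo + suc b + i)  ∎))
    where
    αM₁≤M₁ : ∀ {x} → x ∈ αM₁ → x ≤ suc T
    αM₁≤M₁ x∈ with ∈-++⁻ α x∈
    ... | inj₁ x∈α        = m≤n⇒m≤1+n (proj₂ (α-in x∈α))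
    ... | inj₂ (here refl) = ≤-refl

  -- Pigeonhole: β consists of 1 + b distinct values in (lo, x).
  α-above : ∀ {x} → x ∈ α → lo + suc b < x
  α-above {x} x∈ = go x (proj₁ (α-in x∈)) (λ z∈ → β<αM₁ (∈-++⁺ˡ x∈) z∈)
    where
    go : ∀ x → lo < x → (∀ {z} → z ∈ β → z < x) → lo + suc b < x
    go (suc x) lo<1+x β<1+x = s≤s (Unique-InInterval-length′ x lo β (≤-pred lo<1+x) β-unique
                                     (All.tabulate (λ z∈ → proj₁ (β-in z∈) , ≤-pred (β<1+x z∈))))

  α-bounded : ∀ {x} → x ∈ α → InInterval (lo + suc b) (lo + suc b + i) x
  α-bounded x∈ = α-above x∈ , ≤-trans (proj₂ (α-in x∈)) (≤-reflexive T≡)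
    where
    T≡ : T ≡ lo + suc b + i
    T≡ = trans (cong (lo +_) (trans (sym lengths) (+-comm i (suc b)))) (sym (+-assoc lo (suc b) i))

  α-dumont : Dumont α
  α-dumont = Dumont-++⁻ˡ α (suc T) (2 + T ∷ β) (Block.dumont π-block) (All.tabulate (λ x∈ → s≤s (proj₂ (α-in x∈))))

  β-dumont : Dumont β
  β-dumont = proj₂ (proj₂ (Dumont-++⁻ʳ α (suc T ∷ 2 + T ∷ β) (Block.dumont π-block)))

  -- Were 1 + b odd, the least entry lo + b + 2 of α would be even, so it could be followed
  -- neither by a smaller entry of α nor by the larger 1 + T.
  β-even : 2 ∣ suc b
  β-even with even∨even-suc b
  ... | inj₂ 2∣1+b = 2∣1+b
  ... | inj₁ 2∣b   = ⊥-elim (no-α (length α) refl)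
    where
    n-even : 2 ∣ n
    n-even = even-2+⁻ (Block.even π-block)
    2∣least : 2 ∣ suc (lo + suc b)
    2∣least = subst (2 ∣_) (+-suc lo (suc b)) (∣m∣n⇒∣m+n 2∣lo (even-2+ 2∣b))
    no-α : ∀ k → k ≡ i → ⊥
    no-α zero    0≡i = even⇒odd-suc 2∣b (subst (2 ∣_) (trans (sym lengths) (cong (_+ suc b) (sym 0≡i))) n-even)
    no-α (suc k) 1+k≡i = Dumont-min-odd (lo + suc b) α α-dumont (All.tabulate α-above) least∈α 2∣least
      where
      least∈α : suc (lo + suc b) ∈ α
      least∈α = Unique-InInterval-min∈ (lo + suc b + i) (lo + suc b) α α-unique (All.tabulate α-bounded)
                  (subst (_< i) (sym (trans (cong (λ t → lo + suc b + t ∸ suc (lo + suc b)) (sym 1+k≡i))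
                                            (trans (cong (_∸ suc (lo + suc b)) (+-suc (lo + suc b) k))
                                                   (m+n∸m≡n (lo + suc b) k))))
                         (subst (k <_) 1+k≡i ≤-refl))

  α-even : 2 ∣ i
  α-even = ∣m+n∣m⇒∣n (subst (2 ∣_) (trans (sym lengths) (+-comm i (suc b))) (even-2+⁻ (Block.even π-block))) β-even

  α-block : Block (lo + suc b) i α
  α-block = block (refl , All.tabulate α-bounded) α-unique α-even α-dumont
                  (Avoids-++⁻ˡ pat1-3-2 α _ (Block.avoids132 π-block))

  β-block : Block lo (suc b) β
  β-block = block (refl , All.tabulate β-bounded) β-unique β-even β-dumont
                  (Avoids-++⁻ʳ pat1-3-2 (α ++ suc T ∷ 2 + T ∷ []) β
                    (subst (Avoids pat1-3-2) (sym (++-assoc α (suc T ∷ 2 + T ∷ []) β)) (Block.avoids132 π-block)))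

data Decomposition (lo n : ℕ) : List ℕ → Set where
  enclosed : ∀ {β} → Block lo n β → Decomposition lo n (enclose (lo + n) β)
  spliced  : ∀ {α β} i b → i + suc b ≡ n → Block (lo + suc b) i α → Block lo (suc b) β →
             Decomposition lo n (splice (lo + n) α β)

module _ {lo n : ℕ} (2∣lo : 2 ∣ lo) where
  private
    M₁-odd : 2 ∣ 2 + n → ¬ 2 ∣ suc (lo + n)
    M₁-odd 2∣2+n = even⇒odd-suc (∣m∣n⇒∣m+n 2∣lo (even-2+⁻ 2∣2+n))

  decompose-max-first : ∀ α β → Block lo (2 + n) (α ++ 2 + (lo + n) ∷ β) → suc (lo + n) ∈ β →
                        Decomposition lo n (α ++ 2 + (lo + n) ∷ β)
  decompose-max-first (x ∷ α) β π-block M₁∈β =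
    ⊥-elim (<-irrefl refl (<-≤-trans (AroundMax.β<α (x ∷ α) β π-block (here refl) M₁∈β)
                                     (proj₂ (All.lookup (AroundMax.α-bounded (x ∷ α) β π-block) (here refl)))))
  decompose-max-first [] β π-block M₁∈β with ∈-∃++ M₁∈β
  ... | β₁ , [] , refl = enclosed (enclose-Block⁻ lo n β₁ π-block)
  ... | β₁ , z ∷ s , refl =
    ⊥-elim (<-irrefl refl (<-≤-trans M₁<z (proj₂ (All.lookup (AroundMax.β-bounded [] (β₁ ++ _ ∷ z ∷ s) π-block)
                                                                (∈-++⁺ʳ β₁ (there (here refl)))))))
    where
    M₁<z : suc (lo + n) < z
    M₁<z = proj₂ (Dumont-at (2 + (lo + n) ∷ β₁) (suc (lo + n)) (z ∷ s) (Block.dumont π-block))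
                 (M₁-odd (Block.even π-block))

  decompose-max-second : ∀ α β → Block lo (2 + n) (α ++ 2 + (lo + n) ∷ β) → suc (lo + n) ∈ α →
                         Decomposition lo n (α ++ 2 + (lo + n) ∷ β)
  decompose-max-second α β π-block M₁∈α with ∈-∃++ M₁∈α
  ... | α₁ , z ∷ s , refl =
    ⊥-elim (<-irrefl refl (<-≤-trans M₁<z (proj₂ (All.lookup (AroundMax.α-bounded (α₁ ++ _ ∷ z ∷ s) β π-block)
                                                                (∈-++⁺ʳ α₁ (there (here refl)))))))
    where
    M₁<z : suc (lo + n) < z
    M₁<z = proj₂ (Dumont-at α₁ (suc (lo + n)) (z ∷ s ++ 2 + (lo + n) ∷ β)
                   (subst Dumont (++-assoc α₁ (_ ∷ z ∷ s) (_ ∷ β)) (Block.dumont π-block)))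
                 (M₁-odd (Block.even π-block))
  ... | α₁ , [] , refl with β | subst (Block lo (2 + n)) (++-assoc α₁ (suc (lo + n) ∷ []) (2 + (lo + n) ∷ β)) π-block
  ...   | []     | π-block′ = ⊥-elim (proj₁ (proj₂ (Dumont-++⁻ʳ α₁ _ (Block.dumont π-block′)))
                                       (even-2+ (∣m∣n⇒∣m+n 2∣lo (even-2+⁻ (Block.even π-block′)))))
  ...   | y ∷ β′ | π-block′ = subst (Decomposition lo n) (sym (++-assoc α₁ (suc (lo + n) ∷ []) (2 + (lo + n) ∷ y ∷ β′)))
                                (spliced (length α₁) (length β′) lengths α-block β-block)
    where open SpliceInverse α₁ y β′ 2∣lo π-block′

-- The maximum 2 + lo + n is even, hence followed by something smaller; 1 + lo + n is odd,
-- hence last or followed by something larger, which can only be 2 + lo + n.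
decompose : ∀ lo n {π} → 2 ∣ lo → Block lo (2 + n) π → Decomposition lo n π
decompose lo n {π} 2∣lo π-block
  with α , β , refl ← ∈-∃++ (subst (_∈ π) (cong suc (+-suc lo n)) (Block-max∈ lo (suc n) π-block))
  with ∈-++⁻ α (AroundMax.second∈ α β π-block)
... | inj₂ M₁∈β = decompose-max-first 2∣lo α β π-block M₁∈β
... | inj₁ M₁∈α = decompose-max-second 2∣lo α β π-block M₁∈α

-- The maximum of a nonempty block is even, so it is followed by a smaller entry.
Block-descent : ∀ A lo m {u} → 2 ∣ lo → Block lo (suc m) u → Contains (pat213 A 2) u
Block-descent A lo m 2∣lo u-block with p , s , refl ← ∈-∃++ (Block-max∈ lo m u-block) =
  after-max s (Dumont-at p max s (Block.dumont u-block))
  where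
  max = suc (lo + m)
  max-even : 2 ∣ max
  max-even = subst (2 ∣_) (+-suc lo m) (∣m∣n⇒∣m+n 2∣lo (Block.even u-block))
  after-max : ∀ s → DumontAt max s → Contains (pat213 A 2) (p ++ max ∷ s)
  after-max []       max-odd    = ⊥-elim (max-odd max-even)
  after-max (z ∷ s′) (even , _) =
    descent⇒Contains-21 A (p ++ max ∷ z ∷ s′) (length p) in-range
      (subst₂ _<_ (sym at-z) (sym (at-++-middle p (z ∷ s′) max)) (even max-even))
    where
    in-range : suc (length p) < length (p ++ max ∷ z ∷ s′)
    in-range = subst (suc (length p) <_) (sym (length-++ p))
                 (≤-trans (s≤s (s≤s (m≤m+n (length p) (length s′))))
                          (≤-reflexive (sym (+-2+ (length p) (length s′)))))
    at-z : at (p ++ max ∷ z ∷ s′) (suc (length p)) ≡ z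
    at-z = trans (cong (at (p ++ max ∷ z ∷ s′)) (+-comm 1 (length p))) (at-++ʳ p (max ∷ z ∷ s′) 1)

Block-∷-descent : ∀ A lo {m x u} → 2 ∣ lo → Block lo m (x ∷ u) → Contains (pat213 A 2) (x ∷ u)
Block-∷-descent A lo {u = u} 2∣lo xu-block with refl ← proj₁ (Block.onInterval xu-block) =
  Block-descent A lo (length u) 2∣lo xu-block

module _ (A : ℕ → Bool) (A-suc : ∀ a → A (suc a) ≡ false) where

  Contains-extend : ∀ j (u : List ℕ) t → 2 ≤ j → All (_< t) u →
                    Contains (pat213 A j) u → Contains (pat213 A (suc j)) (u ++ t ∷ [])
  Contains-extend j u t 2≤j u<t (ι , occ) = _ , Occurrence-extend A A-suc j u t ι 2≤j u<t occ

  Contains-enclose : ∀ j T β → 2 ≤ j → All (_< suc T) β →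
                     Contains (pat213 A j) β → Contains (pat213 A (suc j)) (enclose T β)
  Contains-enclose j T β 2≤j β<M₁ β-contains with ι , occ ← Contains-extend j β (suc T) 2≤j β<M₁ β-contains =
    _ , Occurrence-++⁺ʳ (pat213 A (suc j)) (2 + T ∷ []) (β ++ suc T ∷ []) ι occ

  Contains-splice : ∀ j T α β → 2 ≤ j → All (_< suc T) α →
                    Contains (pat213 A j) α → Contains (pat213 A (2 + j)) (splice T α β)
  Contains-splice j T α β 2≤j α<M₁ α-contains
    with ι , occ ← Contains-extend (suc j) (α ++ suc T ∷ []) (2 + T) (≤-trans 2≤j (n≤1+n j))
                     (All.++⁺ (All.map (λ v<M₁ → <-trans v<M₁ ≤-refl) α<M₁) (≤-refl ∷ []))
                     (Contains-extend j α (suc T) 2≤j α<M₁ α-contains) =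
    ι , subst (λ π → Occurrence (pat213 A (2 + j)) π ι)
              (trans (++-assoc (α ++ suc T ∷ []) (2 + T ∷ []) β) (++-assoc α (suc T ∷ []) (2 + T ∷ β)))
              (Occurrence-++⁺ˡ (pat213 A (2 + j)) ((α ++ suc T ∷ []) ++ 2 + T ∷ []) β ι occ)

  splice-avoidsˡ : ∀ r lo i T {α} β → 2 ∣ lo → Block lo i α → All (_< suc T) α →
                   Avoids (pat213 A (3 + r)) (splice T α β) → Avoids (pat213 A (suc r)) α
  splice-avoidsˡ r       lo i T {[]}    β _    _       _    _       = Avoids-[] (pat213 A (suc r)) (s≤s z≤n)
  splice-avoidsˡ zero    lo i T {x ∷ α} β 2∣lo α-block α<M₁ avoids _ =
    avoids (Contains-truncate A (splice T (x ∷ α) β) (s≤s (s≤s (s≤s z≤n)))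
             (Contains-splice 2 T (x ∷ α) β ≤-refl α<M₁
               (Block-∷-descent A lo 2∣lo α-block)))
  splice-avoidsˡ (suc r) lo i T {x ∷ α} β _    _       α<M₁ avoids α-contains =
    avoids (Contains-splice (suc (suc r)) T (x ∷ α) β (s≤s (s≤s z≤n)) α<M₁ α-contains)

  Block⇒∈blocks : ∀ f n → n ≤ f → ∀ r lo {π} → 2 ∣ lo → Block lo n π → Avoids (pat213 A (suc r)) π →
                  π ∈ blocks f r lo n
  Block⇒∈blocks f       zero          _ r lo {[]}    _    _ _ = here refl
  Block⇒∈blocks f       zero          _ r lo {_ ∷ _} _    (block (() , _) _ _ _ _) _
  Block⇒∈blocks f       (suc zero)    _ r lo         _    π-block _ = ⊥-elim (even⇒odd-suc (2 ∣0) (Block.even π-block))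
  Block⇒∈blocks (suc f) (suc (suc n)) _ zero lo {π} 2∣lo π-block avoids =
    ⊥-elim (avoids (Contains-truncate A π (s≤s z≤n) (Block-descent A lo (suc n) 2∣lo π-block)))
  Block⇒∈blocks (suc f) (suc (suc n)) _ (suc zero) lo 2∣lo π-block avoids =
    ⊥-elim (avoids (Block-descent A lo (suc n) 2∣lo π-block))
  Block⇒∈blocks (suc f) (suc (suc n)) 2+n≤1+f (suc (suc r)) lo 2∣lo π-block avoids
    with decompose lo n 2∣lo π-block
  ... | enclosed {β} β-block =
    enclosed-∈ f r lo n (Block⇒∈blocks f n n≤f (suc r) lo 2∣lo β-block
      (λ β-contains → avoids (Contains-enclose (2 + r) (lo + n) β (s≤s (s≤s z≤n)) (β<M₁ β-block) β-contains)))
    where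
    n≤f = ≤-pred (≤-trans (n≤1+n (suc n)) 2+n≤1+f)
    β<M₁ : ∀ {β} → Block lo n β → All (_< suc (lo + n)) β
    β<M₁ β-block = All.map (λ (_ , v≤) → s≤s v≤) (proj₂ (Block.onInterval β-block))
  ... | spliced {α} {β} i b i+1+b≡n α-block β-block =
    spliced-∈ f r lo n i b i+1+b≡n
      (Block⇒∈blocks f i (≤-trans (m≤m+n i (suc b)) (≤-trans (≤-reflexive i+1+b≡n) n≤f)) r (lo + suc b) 2∣lo+1+b α-block
        (splice-avoidsˡ r (lo + suc b) i (lo + n) β 2∣lo+1+b α-block α<M₁ avoids))
      (Block⇒∈blocks f (suc b) (≤-trans (m≤n+m (suc b) i) (≤-trans (≤-reflexive i+1+b≡n) n≤f)) (2 + r) lo 2∣lo β-block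
        (Avoids-++⁻ʳ (pat213 A (3 + r)) (α ++ suc (lo + n) ∷ 2 + (lo + n) ∷ []) β
          (subst (Avoids (pat213 A (3 + r))) (sym (++-assoc α (suc (lo + n) ∷ 2 + (lo + n) ∷ []) β)) avoids)))
    where
    n≤f = ≤-pred (≤-trans (n≤1+n (suc n)) 2+n≤1+f)
    2∣lo+1+b : 2 ∣ lo + suc b
    2∣lo+1+b = ∣m∣n⇒∣m+n 2∣lo (Block.even β-block)
    open SpliceBounds i+1+b≡n (Block.onInterval α-block) (Block.onInterval β-block)

Block⇒IsPerm : ∀ {n π} → Block 0 n π → IsPerm n π
Block⇒IsPerm (block (π-length , π-bounded) π-unique _ _ _) = π-length , π-unique , π-bounded

withMaxLast : ℕ → ℕ → List (List ℕ)
withMaxLast r zero    = []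
withMaxLast r (suc m) = map (_++ suc m ∷ []) (blocks m r 0 m)

dumontAvoiders : ℕ → ℕ → List (List ℕ)
dumontAvoiders r n = blocks n (suc r) 0 n ++ withMaxLast r n

length-dumontAvoiders : ∀ r n → length (dumontAvoiders r n) ≡ G (suc r) n + shift1 (G r) n
length-dumontAvoiders r n =
  trans (length-++ (blocks n (suc r) 0 n)) (cong₂ _+_ (length-blocks n n ≤-refl (suc r) 0) (length-withMaxLast n))
  where
  length-withMaxLast : ∀ n → length (withMaxLast r n) ≡ shift1 (G r) n
  length-withMaxLast zero    = refl
  length-withMaxLast (suc m) = trans (length-map _ (blocks m r 0 m)) (length-blocks m m ≤-refl r 0)

dumontAvoiders-Unique : ∀ r n → Unique (dumontAvoiders r n)
dumontAvoiders-Unique r n =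
  Unique.++⁺ (blocks-Unique n (suc r) 0 n) (withMaxLast-Unique n) (λ (w∈ , w∈′) → disjoint n w∈ w∈′)
  where
  withMaxLast-Unique : ∀ n → Unique (withMaxLast r n)
  withMaxLast-Unique zero    = []
  withMaxLast-Unique (suc m) = Unique.map⁺ (λ {x} {y} → ∷ʳ-injectiveˡ x y) (blocks-Unique m r 0 m)
  disjoint : ∀ n {w} → w ∈ blocks n (suc r) 0 n → w ∈ withMaxLast r n → ⊥
  disjoint (suc m) w∈ w∈′ with π , π∈ , refl ← ∈-map⁻ (_++ suc m ∷ []) w∈′ =
    even⇒odd-suc (Block.even (blocks-Block m r 0 m (2 ∣0) π∈))
                 (Block.even (blocks-Block (suc m) (suc r) 0 (suc m) (2 ∣0) w∈))

Block-∷ʳ-max : ∀ {m π} → Block 0 m π →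
               IsPerm (suc m) (π ++ suc m ∷ []) × Dumont (π ++ suc m ∷ []) × Avoids pat1-3-2 (π ++ suc m ∷ [])
Block-∷ʳ-max {m} {π} (block (π-length , π-bounded) π-unique 2∣m π-dumont π-avoids) =
  (length≡ , Unique.++⁺ π-unique ([] ∷ []) (λ { (v∈ , here refl) → <-irrefl refl (All.lookup π<1+m v∈) }) ,
   All.++⁺ (All.map (λ (0<v , v≤m) → 0<v , m≤n⇒m≤1+n v≤m) π-bounded) ((s≤s z≤n , ≤-refl) ∷ [])) ,
  Dumont-++⁺ π (suc m) [] π-dumont (even⇒odd-suc 2∣m , tt) π<1+m ,
  Avoids-132-∷ʳ π (suc m) π-avoids π<1+m
  where
  π<1+m : All (_< suc m) π
  π<1+m = All.map (λ (_ , v≤m) → s≤s v≤m) π-bounded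
  length≡ : length (π ++ suc m ∷ []) ≡ suc m
  length≡ = trans (length-++ π) (trans (cong (_+ 1) π-length) (+-comm m 1))

dumontAvoiders-sound : ∀ A r n {w} → w ∈ dumontAvoiders r n →
                       IsPerm n w × IsDumont w × Avoids pat1-3-2 w × Avoids (pat213 A (2 + r)) w
dumontAvoiders-sound A r n {w} w∈ with ∈-++⁻ (blocks n (suc r) 0 n) w∈
... | inj₁ w∈blocks with w-block ← blocks-Block n (suc r) 0 n (2 ∣0) w∈blocks =
  Block⇒IsPerm w-block , Dumont⇒IsDumont w (Block.dumont w-block) , Block.avoids132 w-block ,
  blocks-avoid A n (suc r) 0 n w∈blocks
dumontAvoiders-sound A r (suc m) _ | inj₂ w∈withMaxLast
  with π , π∈ , refl ← ∈-map⁻ (_++ suc m ∷ []) w∈withMaxLast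
  with w-perm , w-dumont , w-avoids ← Block-∷ʳ-max (blocks-Block m r 0 m (2 ∣0) π∈) =
  w-perm , Dumont⇒IsDumont _ w-dumont , w-avoids ,
  subst (λ k → Avoids (pat213 A k) (π ++ suc m ∷ [])) (+-comm (suc r) 1)
        (Avoids-213-++-tail A (suc r) 1 π (suc m ∷ []) ≤-refl (blocks-avoid A m r 0 m π∈))

IsPerm⇒Block : ∀ {n π} → 2 ∣ n → IsPerm n π → Dumont π → Avoids pat1-3-2 π → Block 0 n π
IsPerm⇒Block 2∣n (π-length , π-unique , π-bounded) = block (π-length , π-bounded) π-unique 2∣n

-- The maximum 1 + m is odd and has no larger successor, so it is last.
odd-IsPerm-max-last : ∀ {m} p s → 2 ∣ m → IsPerm (suc m) (p ++ suc m ∷ s) → Dumont (p ++ suc m ∷ s) →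
                      Avoids pat1-3-2 (p ++ suc m ∷ s) → s ≡ [] × Block 0 m p
odd-IsPerm-max-last {m} p (z ∷ s) 2∣m (_ , _ , w-bounded) w-dumont _ =
  ⊥-elim (<-irrefl refl (<-≤-trans (proj₂ (Dumont-at p (suc m) (z ∷ s) w-dumont) (even⇒odd-suc 2∣m))
                                   (proj₂ (All.lookup w-bounded (∈-++⁺ʳ p (there (here refl)))))))
odd-IsPerm-max-last {m} p [] 2∣m (w-length , w-unique , w-bounded) w-dumont w-avoids =
  refl , block (p-length , All.tabulate p-bounded) (proj₁ (Unique-++⁻ p (suc m ∷ []) w-unique)) 2∣m
               (Dumont-++⁻ˡ p (suc m) [] w-dumont (All.tabulate (λ v∈ → s≤s (proj₂ (p-bounded v∈)))))
               (Avoids-++⁻ˡ pat1-3-2 p (suc m ∷ []) w-avoids)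
  where
  p-length : length p ≡ m
  p-length = +-cancelʳ-≡ 1 (length p) m (trans (trans (sym (length-++ p)) w-length) (+-comm 1 m))
  p-bounded : ∀ {v} → v ∈ p → InInterval 0 m v
  p-bounded v∈ = InInterval-shrink (Unique-++-≢ p (suc m ∷ []) w-unique v∈ (here refl)) (All.lookup w-bounded (∈-++⁺ˡ v∈))

module _ (A : ℕ → Bool) (A-suc : ∀ a → A (suc a) ≡ false) where

  withMaxLast-avoids : ∀ r {m p} → Block 0 m p → Avoids (pat213 A (2 + r)) (p ++ suc m ∷ []) →
                       Avoids (pat213 A (suc r)) p
  withMaxLast-avoids r       {p = []}    _       _      = Avoids-[] (pat213 A (suc r)) (s≤s z≤n)
  withMaxLast-avoids zero    {p = x ∷ p} p-block avoids _ with ι , occ ←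
    Block-∷-descent A 0 (2 ∣0) p-block =
    avoids (ι , Occurrence-++⁺ˡ (pat213 A 2) (x ∷ p) _ ι occ)
  withMaxLast-avoids (suc r) {m} {x ∷ p} p-block avoids p-contains =
    avoids (Contains-extend A A-suc (2 + r) (x ∷ p) (suc m) (s≤s (s≤s z≤n))
             (All.map (λ (_ , v≤m) → s≤s v≤m) (proj₂ (Block.onInterval p-block))) p-contains)

  dumontAvoiders-complete : ∀ r n {w} → IsPerm n w → IsDumont w → Avoids pat1-3-2 w → Avoids (pat213 A (2 + r)) w →
                            w ∈ dumontAvoiders r n
  dumontAvoiders-complete r n {w} w-perm w-dumont w-avoids avoids with even∨odd n
  ... | inj₁ 2∣n = ∈-++⁺ˡ (Block⇒∈blocks A A-suc n n ≤-refl (suc r) 0 (2 ∣0)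
                            (IsPerm⇒Block 2∣n w-perm (IsDumont⇒Dumont w w-dumont) w-avoids) avoids)
  ... | inj₂ (m , refl , 2∣m)
    with p , s , refl ← ∈-∃++ (Unique-InInterval-max∈ m 0 w (proj₁ (proj₂ w-perm)) (proj₂ (proj₂ w-perm))
                                                   (≤-reflexive (sym (proj₁ w-perm))))
    with refl , p-block ← odd-IsPerm-max-last p s 2∣m w-perm (IsDumont⇒Dumont _ w-dumont) w-avoids =
    ∈-++⁺ʳ (blocks (suc m) (suc r) 0 (suc m))
      (∈-map⁺ (_++ suc m ∷ []) (Block⇒∈blocks A A-suc m m ≤-refl r 0 (2 ∣0) p-block (withMaxLast-avoids r p-block avoids)))

  dumontAvoiders-HasSize : ∀ r n τ → (∀ π → Avoids τ π ⇔ Avoids (pat213 A (2 + r)) π) →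
                           HasSize (DumontAvoiding n τ) (G (suc r) n + shift1 (G r) n)
  dumontAvoiders-HasSize r n τ τ⇔ =
    dumontAvoiders r n , dumontAvoiders-Unique r n , length-dumontAvoiders r n ,
    λ w → mk⇔ (λ w∈ → let (w-perm , w-dumont , w-avoids , avoids) = dumontAvoiders-sound A r n w∈
                       in w-perm , w-dumont , w-avoids , Equivalence.from (τ⇔ w) avoids)
              (λ (w-perm , w-dumont , w-avoids , avoids) →
                 dumontAvoiders-complete r n w-perm w-dumont w-avoids (Equivalence.to (τ⇔ w) avoids))

adj21 : ℕ → Bool
adj21 zero    = true
adj21 (suc _) = false

Avoids-pat21-3-k⇔ : ∀ k π → Avoids (pat21-3-k k) π ⇔ Avoids (pat213 adj21 k) π
Avoids-pat21-3-k⇔ k π = mk⇔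
  (λ avoids (ι , mono , inside , adjacent , iso) →
     avoids (ι , mono , inside , (λ a 1+a<k adj≡ → adjacent a 1+a<k (trans (sym (same-adj a)) adj≡)) , iso))
  (λ avoids (ι , mono , inside , adjacent , iso) →
     avoids (ι , mono , inside , (λ a 1+a<k adj≡ → adjacent a 1+a<k (trans (same-adj a) adj≡)) , iso))
  where
  same-adj : ∀ a → adj (pat21-3-k k) a ≡ adj21 a
  same-adj zero    = refl
  same-adj (suc a) = refl

theorem2p13 : (k : ℕ) → 2 ≤ k → (n : ℕ) →
      HasSize (DumontAvoiding n (pat21-3-k k)) ((G (k ∸ 1) ⊕ shift1 (G (k ∸ 2))) n)
    × HasSize (DumontAvoiding n (pat2-1-3-k k)) ((G (k ∸ 1) ⊕ shift1 (G (k ∸ 2))) n)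
theorem2p13 (suc zero) (s≤s ()) n
theorem2p13 (suc (suc r)) _ n =
  dumontAvoiders-HasSize adj21 (λ _ → refl) r n (pat21-3-k (2 + r)) (Avoids-pat21-3-k⇔ (2 + r)) ,
  dumontAvoiders-HasSize (λ _ → false) (λ _ → refl) r n (pat2-1-3-k (2 + r)) (λ _ → ⇔-id _)
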